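{- Let $\mathbb{K}$ be a semiring. If $f\colon\mathbb{N}^d\to\mathbb{N}^{d'}$ is an $(\boldsymbol{\mathcal{S}},\boldsymbol{\mathcal{S}}')$-synchronized sequence and $g\colon\mathbb{N}^{d'}\to\mathbb{K}$ is an $(\boldsymbol{\mathcal{S}}',\mathbb{K})$-regular sequence, then $g\circ f\colon\mathbb{N}^d\to\mathbb{K}$ is $(\boldsymbol{\mathcal{S}},\mathbb{K})$-regular.
   Context: An abstract numeration system is a triple $\mathcal{S}=(L,A,<)$ where $L$ is an infinite regular language over a finite alphabet $A$ totally ordered by $<$. Words are ordered by the radix order ($u<_{\rm rad}v$ iff $|u|<|v|$, or $|u|=|v|$ and $u$ is lexicographically smaller); $\mathrm{rep}_{\mathcal{S}}\colon\mathbb{N}\to L$ maps $n$ to the $n$-th word of $L$ (indexing from $0$) and $\mathrm{val}_{\mathcal{S}}$ is its inverse. For $e\ge1$, abstract numeration systems $\mathcal{T}_j=(K_j,B_j,<_j)$ and a symbol $\#\notin\bigcup_jB_j$, the $e$-dimensional system $\boldsymbol{\mathcal{T}}=(\mathcal{T}_1,\dots,\mathcal{T}_e)$ has alphabet $\boldsymbol{B}=\big((B_1\cup\{\#\})\times\cdots\times(B_e\cup\{\#\})\big)\setminus\{(\#,\dots,\#)\}$, numeration language $\boldsymbol{K}$ consisting of the words over $\boldsymbol{B}$ obtained from $(w_1,\dots,w_e)\in K_1\times\cdots\times K_e$ by left-padding each $w_j$ with $\#$'s to the maximal length and reading them in parallel, and $\mathrm{rep}_{\boldsymbol{\mathcal{T}}}(n_1,\dots,n_e)$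 is the word so obtained from $(\mathrm{rep}_{\mathcal{T}_1}(n_1),\dots,\mathrm{rep}_{\mathcal{T}_e}(n_e))$, a bijection $\mathbb{N}^e\to\boldsymbol{K}$ with inverse $\mathrm{val}_{\boldsymbol{\mathcal{T}}}$. A set $X\subseteq\mathbb{N}^e$ is $\boldsymbol{\mathcal{T}}$-recognizable if $\mathrm{rep}_{\boldsymbol{\mathcal{T}}}(X)$ is regular. $\boldsymbol{\mathcal{S}}$ and $\boldsymbol{\mathcal{S}}'$ are such systems of dimensions $d$ and $d'$, and $(\boldsymbol{\mathcal{S}},\boldsymbol{\mathcal{S}}')$ is their concatenation. $f$ is $(\boldsymbol{\mathcal{S}},\boldsymbol{\mathcal{S}}')$-synchronized if its graph $\{(\boldsymbol{n},f(\boldsymbol{n})):\boldsymbol{n}\in\mathbb{N}^d\}$ is $(\boldsymbol{\mathcal{S}},\boldsymbol{\mathcal{S}}')$-recognizable. A series $S\colon A^*\to\mathbb{K}$ is $\mathbb{K}$-recognizable if there exist $r\ge1$, a monoid morphism $\mu\colon A^*\to\mathbb{K}^{r\times r}$, $\lambda\in\mathbb{K}^{1\times r}$, $\gamma\in\mathbb{K}^{r\times1}$ with $(S,w)=\lambda\mu(w)\gamma$ for all $w$. A sequence $h\colon\mathbb{N}^e\to\mathbb{K}$ is $(\boldsymbol{\mathcal{T}},\mathbb{K})$-regular if the series $\sum_{\boldsymbol{w}\in\boldsymbol{K}}h(\mathrm{val}_{\boldsymbol{\mathcal{T}}}(\boldsymbol{w}))\,\boldsymbol{w}$ over $\boldsymbol{B}$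 is $\mathbb{K}$-recognizable. -}

module Defs where

open import Level using (Level; _⊔_)
open import Data.Nat using (ℕ; zero; suc; _<ᵇ_; _≡ᵇ_; _≤_; _∸_)
open import Data.Nat.ListAction using (sum)
open import Data.Bool using (Bool; true; false; _∧_; _∨_; if_then_else_)
open import Data.Fin using (Fin; toℕ; _≟_)
import Data.Fin as Fin
open import Data.Maybe using (Maybe; just; nothing)
open import Data.List using (List; []; _∷_; map; concatMap; length; replicate; _++_; upTo; allFin)
open import Data.Vec as Vec using (Vec; lookup; tabulate)
open import Data.Product using (Σ; _×_; _,_; proj₁)
open import Relation.Nullary using (¬_; yes; no)
open import Relation.Binary.PropositionalEquality using (_≡_)
open import Algebra.Bundles using (Semiring)

record DFA (A : Set) : Set where
  field
    nStates : ℕ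
    start   : Fin nStates
    δ       : Fin nStates → A → Fin nStates
    final   : Fin nStates → Bool

runDFA : ∀ {A} (D : DFA A) → Fin (DFA.nStates D) → List A → Fin (DFA.nStates D)
runDFA D q []      = q
runDFA D q (a ∷ w) = runDFA D (DFA.δ D q a) w

accepts : ∀ {A} → DFA A → List A → Bool
accepts D w = DFA.final D (runDFA D (DFA.start D) w)

RegularLang : ∀ {A : Set} → (List A → Set) → Set
RegularLang {A} P =
  Σ (DFA A) λ D → ∀ (w : List A) → (accepts D w ≡ true → P w) × (P w → accepts D w ≡ true)

-- Abstract numeration systems.  The finite totally ordered alphabet is
-- (up to order isomorphism) Fin k with its natural order; the regular
-- language L is given by a DFA; L must be infinite.

record ANS : Set where
  field
    alph     : ℕ
    dfa      : DFA (Fin alph)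
    infinite : ∀ (n : ℕ) → Σ (List (Fin alph)) λ w → (n ≤ length w) × (accepts dfa w ≡ true)

Word : ANS → Set
Word S = List (Fin (ANS.alph S))

InL : (S : ANS) → Word S → Set
InL S w = accepts (ANS.dfa S) w ≡ true

wordsOfLength : (k : ℕ) → ℕ → List (List (Fin k))
wordsOfLength k zero    = [] ∷ []
wordsOfLength k (suc n) = concatMap (λ a → map (a ∷_) (wordsOfLength k n)) (allFin k)

-- lexicographic strict order (used on words of equal length)
lexLt : ∀ {k} → List (Fin k) → List (Fin k) → Bool
lexLt []      _       = false
lexLt (_ ∷ _) []      = false
lexLt (a ∷ u) (b ∷ v) = (toℕ a <ᵇ toℕ b) ∨ ((toℕ a ≡ᵇ toℕ b) ∧ lexLt u v)

radixLt : ∀ {k} → List (Fin k) → List (Fin k) → Bool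
radixLt u v = (length u <ᵇ length v) ∨ ((length u ≡ᵇ length v) ∧ lexLt u v)

-- val_S(u) = number of words of L that are radix-smaller than u;
-- for u ∈ L this is the index n with rep_S(n) = u.
val : (S : ANS) → Word S → ℕ
val S u = sum (map (λ v → if accepts (ANS.dfa S) v ∧ radixLt v u then 1 else 0)
                   (concatMap (wordsOfLength (ANS.alph S)) (upTo (suc (length u)))))

-- e-dimensional systems: a vector of e ANS.  Letters of the product
-- alphabet: tuples over (B_j ∪ {#}) (with # = nothing), not all #.

System : ℕ → Set
System e = Vec ANS e

Letter : ∀ {e} → System e → Set
Letter {e} T =
  Σ ((j : Fin e) → Maybe (Fin (ANS.alph (lookup T j))))
    λ v → ¬ (∀ j → v j ≡ nothing)

MWord : ∀ {e} → System e → Set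
MWord T = List (Letter T)

track : ∀ {e} (T : System e) (j : Fin e) → MWord T → List (Maybe (Fin (ANS.alph (lookup T j))))
track T j w = map (λ b → proj₁ b j) w

-- w is the padded parallel reading of the tuple us, with us j ∈ L_j:
-- w ∈ K and val_T(w) is the tuple of val_j (us j).
Encodes : ∀ {e} (T : System e) → MWord T → ((j : Fin e) → Word (lookup T j)) → Set
Encodes {e} T w us =
  ∀ (j : Fin e) → InL (lookup T j) (us j)
                × (track T j w ≡ replicate (length w ∸ length (us j)) nothing ++ map just (us j))

InK : ∀ {e} (T : System e) → MWord T → Set
InK {e} T w = Σ ((j : Fin e) → Word (lookup T j)) λ us → Encodes T w us

valT : ∀ {e} (T : System e) → ((j : Fin e) → Word (lookup T j)) → Vec ℕ e
valT T us = tabulate (λ j → val (lookup T j) (us j))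

Recognizable : ∀ {e} (T : System e) → (Vec ℕ e → Set) → Set
Recognizable {e} T X =
  RegularLang {Letter T} (λ w → Σ ((j : Fin e) → Word (lookup T j)) λ us → Encodes T w us × X (valT T us))

_⊕_ : ∀ {d d'} → System d → System d' → System (d Data.Nat.+ d')
S ⊕ S' = S Vec.++ S'

Synchronized : ∀ {d d'} (S : System d) (S' : System d') → (Vec ℕ d → Vec ℕ d') → Set
Synchronized {d} {d'} S S' f =
  Recognizable (S ⊕ S') (λ x → Σ (Vec ℕ d) λ n → x ≡ n Vec.++ f n)

module _ {c ℓ : Level} (𝕂 : Semiring c ℓ) where
  open Semiring 𝕂

  Mat : ℕ → Set c
  Mat r = Fin r → Fin r → Carrier

  sumFin : ∀ {r} → (Fin r → Carrier) → Carrier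
  sumFin {zero}  f = 0#
  sumFin {suc r} f = f Fin.zero + sumFin (λ i → f (Fin.suc i))

  matMul : ∀ {r} → Mat r → Mat r → Mat r
  matMul M N i j = sumFin (λ l → M i l * N l j)

  idMat : ∀ {r} → Mat r
  idMat i j with i ≟ j
  ... | yes _ = 1#
  ... | no  _ = 0#

  record LinRep (A : Set) : Set c where
    field
      dim : ℕ
      μ   : A → Mat dim
      λv  : Fin dim → Carrier
      γ   : Fin dim → Carrier

  μ* : ∀ {A} (R : LinRep A) → List A → Mat (LinRep.dim R)
  μ* R []      = idMat
  μ* R (a ∷ w) = matMul (LinRep.μ R a) (μ* R w)

  evalRep : ∀ {A} (R : LinRep A) → List A → Carrier
  evalRep R w = sumFin (λ i → sumFin (λ j → (LinRep.λv R i * μ* R w i j) * LinRep.γ R j))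

  -- h : ℕ^e → 𝕂 is (T,𝕂)-regular: the series Σ_{w ∈ K} h(val_T w) w
  -- (coefficient h(val_T w) on K, 0 outside K) is 𝕂-recognizable.
  RegularSeq : ∀ {e} (T : System e) → (Vec ℕ e → Carrier) → Set (c ⊔ ℓ)
  RegularSeq T h =
    Σ (LinRep (Letter T)) λ R → ∀ (w : MWord T) →
        (∀ us → Encodes T w us → evalRep R w ≈ h (valT T us))
      × (¬ InK T w → evalRep R w ≈ 0#)

module Submission where

-- Let D be a DFA recognizing the graph of f (over S ⊕ S′) with states Q, and
-- (λ, μ, γ) a linear representation of g of dimension r.  The composed
-- representation has states Q × [r]: on a letter a of S it guesses the tuple
-- c of S′-letters read in parallel (possibly all #), moves D on (a, c) and
-- multiplies by μ(c) (by the identity if c is all #); γ keeps the final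
-- states of D.  Since rep(f(n)) may be longer than rep(n), the initial vector
-- also guesses a prefix p, # on the S-tracks, and starts D after p with weight
-- λ μ(p).  So λ′ μ′(w) γ′ is the sum of λ μ(v) γ over the S′-words v read by
-- accepting runs on words of the form p·(w, c₁⋯cₖ).  Such a word encodes
-- (n, f(n)) where w encodes n, hence is unique by injectivity of val; and p
-- is shorter than |Q|, since cutting a loop out of p would yield another,
-- shorter, accepted word.  The sum therefore is g(f(n)) if w encodes some n,
-- and 0 otherwise.

open import Defs
open import Data.Nat using (ℕ; _≤_)
open import Data.Vec using (Vec)
open import Algebra.Bundles using (Semiring)
open import Function using (_∘_)
open import Data.Bool using (true)
open import Data.Fin using (Fin)
open import Data.Maybe using (Maybe; just; nothing)
open import Data.Product using (Σ; _×_; _,_; proj₁; proj₂)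
open import Data.Vec using (lookup)
open import Relation.Binary.PropositionalEquality as ≡ using (_≡_; _≢_)
open import Relation.Nullary using (¬_; Dec; yes; no)

module SemiringSums {c ℓ} (𝕂 : Semiring c ℓ) where

  open import Data.Nat as ℕ using (zero; suc)
  open import Relation.Nullary using (yes; no; does; contradiction)
  open import Data.Bool using (Bool; true; false; if_then_else_)
  open import Data.Fin using (Fin; zero; suc; combine; _↑ˡ_; _↑ʳ_)
  open import Data.List as List using (List; []; _∷_; _++_; map; concatMap; tabulate)
  open import Relation.Binary.PropositionalEquality as ≡ using (_≡_; _≢_)
  open Semiring 𝕂 hiding (zero)
  open import Algebra.Properties.Semiring.Sum 𝕂 public
    using (sum; sum-cong-≋; sum-replicate-zero; ∑-comm; ∑-distrib-+; *-distribˡ-sum; *-distribʳ-sum)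
  open import Relation.Binary.Reasoning.Setoid setoid

  sumFin≈sum : ∀ {r} {f g : Fin r → Carrier} → (∀ i → f i ≈ g i) → sumFin 𝕂 f ≈ sum g
  sumFin≈sum {zero}  f≈g = refl
  sumFin≈sum {suc r} f≈g = +-cong (f≈g zero) (sumFin≈sum (f≈g ∘ suc))

  sum-zero : ∀ {r} {f : Fin r → Carrier} → (∀ i → f i ≈ 0#) → sum f ≈ 0#
  sum-zero {r} f≈0 = trans (sum-cong-≋ f≈0) (sum-replicate-zero r)

  sum-single : ∀ {r} (i : Fin r) {f : Fin r → Carrier} → (∀ j → j ≢ i → f j ≈ 0#) → sum f ≈ f i
  sum-single zero    f≈0 = trans (+-congˡ (sum-zero (λ j → f≈0 (suc j) λ ()))) (+-identityʳ _)
  sum-single (suc i) f≈0 =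
    trans (+-cong (f≈0 zero λ ()) (sum-single i (λ j j≢i → f≈0 (suc j) (j≢i ∘ Data.Fin.Properties.suc-injective))))
          (+-identityˡ _)
    where import Data.Fin.Properties

  sum-↑ : ∀ m n (f : Fin (m ℕ.+ n) → Carrier) → sum f ≈ sum (f ∘ (_↑ˡ n)) + sum (f ∘ (m ↑ʳ_))
  sum-↑ zero    n f = sym (+-identityˡ _)
  sum-↑ (suc m) n f = trans (+-congˡ (sum-↑ m n (f ∘ suc))) (sym (+-assoc _ _ _))

  sum-combine : ∀ m n (f : Fin (m ℕ.* n) → Carrier) → sum f ≈ sum {m} (λ q → sum {n} (λ i → f (combine q i)))
  sum-combine zero    n f = refl
  sum-combine (suc m) n f = trans (sum-↑ n (m ℕ.* n) f) (+-congˡ (sum-combine m n (f ∘ (n ↑ʳ_))))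

  when : Bool → Carrier → Carrier
  when b x = if b then x else 0#

  when-cong : ∀ b {x y} → x ≈ y → when b x ≈ when b y
  when-cong true  x≈y = x≈y
  when-cong false _   = refl

  when-*ʳ : ∀ b x y → when b x * y ≈ when b (x * y)
  when-*ʳ true  x y = refl
  when-*ʳ false x y = zeroˡ y

  when-*ˡ : ∀ b x y → y * when b x ≈ when b (y * x)
  when-*ˡ true  x y = refl
  when-*ˡ false x y = zeroʳ y

  sum-when : ∀ {r} b (f : Fin r → Carrier) → sum (λ i → when b (f i)) ≈ when b (sum f)
  sum-when true  f = refl
  sum-when {r} false f = sum-zero {r} (λ _ → refl)

  sum-when-≟ : ∀ {n} (x : Fin n) (h : Fin n → Carrier) → sum (λ y → when (does (x Data.Fin.≟ y)) (h y)) ≈ h x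
  sum-when-≟ x h = trans (sum-single x off) on
    where
    off : ∀ y → y ≢ x → when (does (x Data.Fin.≟ y)) (h y) ≈ 0#
    off y y≢x with x Data.Fin.≟ y
    ... | yes x≡y = contradiction (≡.sym x≡y) y≢x
    ... | no  _   = refl
    on : when (does (x Data.Fin.≟ x)) (h x) ≈ h x
    on with x Data.Fin.≟ x
    ... | yes _   = refl
    ... | no  x≢x = contradiction ≡.refl x≢x

  -- Defined through lookup so that the lemmas on finite sums apply; on
  -- x ∷ xs it still unfolds definitionally to f x + lsum xs f.
  lsum : ∀ {X : Set} → List X → (X → Carrier) → Carrier
  lsum xs f = sum (f ∘ List.lookup xs)

  lsum-zero : ∀ {X : Set} (xs : List X) → lsum xs (λ _ → 0#) ≈ 0#
  lsum-zero xs = sum-zero {List.length xs} (λ _ → refl)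

  lsum-++ : ∀ {X : Set} (xs ys : List X) (f : X → Carrier) → lsum (xs ++ ys) f ≈ lsum xs f + lsum ys f
  lsum-++ []       ys f = sym (+-identityˡ _)
  lsum-++ (x ∷ xs) ys f = trans (+-congˡ (lsum-++ xs ys f)) (sym (+-assoc _ _ _))

  lsum-map : ∀ {X Y : Set} (g : X → Y) (xs : List X) (f : Y → Carrier) → lsum (map g xs) f ≡ lsum xs (f ∘ g)
  lsum-map g []       f = ≡.refl
  lsum-map g (x ∷ xs) f = ≡.cong (f (g x) +_) (lsum-map g xs f)

  lsum-tabulate : ∀ {X : Set} {n} (g : Fin n → X) (f : X → Carrier) → lsum (tabulate g) f ≈ sum (f ∘ g)
  lsum-tabulate {n = zero}  g f = refl
  lsum-tabulate {n = suc n} g f = +-congˡ (lsum-tabulate (g ∘ suc) f)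

  lsum-+ : ∀ {X : Set} (xs : List X) (f g : X → Carrier) → lsum xs (λ x → f x + g x) ≈ lsum xs f + lsum xs g
  lsum-+ xs f g = ∑-distrib-+ (f ∘ List.lookup xs) (g ∘ List.lookup xs)

  sum-*-lsum-when : ∀ {X : Set} {n} (xs : List X) (M : Fin n → Carrier) (B : X → Bool) (G : X → Fin n → Carrier) →
                   sum (λ i → M i * lsum xs (λ x → when (B x) (G x i))) ≈ lsum xs (λ x → when (B x) (sum (λ i → M i * G x i)))
  sum-*-lsum-when {n = n} xs M B G = begin
    sum {n} (λ i → M i * lsum xs (λ x → when (B x) (G x i)))
      ≈⟨ sum-cong-≋ {n} (λ i → trans (*-distribˡ-sum (M i) (λ l → when (B (List.lookup xs l)) (G (List.lookup xs l) i)))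
                                     (sum-cong-≋ {List.length xs} (λ l → when-*ˡ (B (List.lookup xs l)) _ (M i)))) ⟩
    sum {n} (λ i → lsum xs (λ x → when (B x) (M i * G x i)))
      ≈⟨ ∑-comm {n} {List.length xs} (λ i l → when (B (List.lookup xs l)) (M i * G (List.lookup xs l) i)) ⟩
    lsum xs (λ x → sum {n} (λ i → when (B x) (M i * G x i)))
      ≈⟨ sum-cong-≋ {List.length xs} (λ l → sum-when (B (List.lookup xs l)) (λ i → M i * G (List.lookup xs l) i)) ⟩
    lsum xs (λ x → when (B x) (sum {n} (λ i → M i * G x i))) ∎

  lsum-concatMap : ∀ {X Y : Set} (g : X → List Y) (xs : List X) (f : Y → Carrier) →
                   lsum (concatMap g xs) f ≈ lsum xs (λ x → lsum (g x) f)
  lsum-concatMap g []       f = refl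
  lsum-concatMap g (x ∷ xs) f = trans (lsum-++ (g x) _ f) (+-congˡ (lsum-concatMap g xs f))

  sum-transition : ∀ {m n k} (x : Fin k → Fin m) (M : Fin k → Fin n → Carrier) (Y : Fin m → Fin n → Carrier) →
                   sum (λ q′ → sum (λ i′ → sum (λ c → when (does (x c Data.Fin.≟ q′)) (M c i′)) * Y q′ i′))
                   ≈ sum (λ c → sum (λ i′ → M c i′ * Y (x c) i′))
  sum-transition {m} {n} {k} x M Y = begin
    sum {m} (λ q′ → sum {n} (λ i′ → sum {k} (λ c → when (does (x c Data.Fin.≟ q′)) (M c i′)) * Y q′ i′))
      ≈⟨ sum-cong-≋ {m} (λ q′ → sum-cong-≋ {n} (λ i′ → pull q′ i′)) ⟩
    sum {m} (λ q′ → sum {n} (λ i′ → sum {k} (λ c → W q′ c i′)))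
      ≈⟨ sum-cong-≋ {m} (λ q′ → ∑-comm {n} {k} (λ i′ c → W q′ c i′)) ⟩
    sum {m} (λ q′ → sum {k} (λ c → sum {n} (λ i′ → W q′ c i′)))
      ≈⟨ ∑-comm {m} {k} (λ q′ c → sum {n} (λ i′ → W q′ c i′)) ⟩
    sum {k} (λ c → sum {m} (λ q′ → sum {n} (λ i′ → W q′ c i′)))
      ≈⟨ sum-cong-≋ {k} (λ c → trans (sum-cong-≋ {m} (λ q′ → sum-when (does (x c Data.Fin.≟ q′)) (λ i′ → M c i′ * Y q′ i′)))
                                     (sum-when-≟ (x c) (λ q′ → sum {n} (λ i′ → M c i′ * Y q′ i′)))) ⟩
    sum {k} (λ c → sum {n} (λ i′ → M c i′ * Y (x c) i′)) ∎
    where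
    W : Fin m → Fin k → Fin n → Carrier
    W q′ c i′ = when (does (x c Data.Fin.≟ q′)) (M c i′ * Y q′ i′)
    pull : ∀ q′ i′ → sum {k} (λ c → when (does (x c Data.Fin.≟ q′)) (M c i′)) * Y q′ i′ ≈ sum {k} (λ c → W q′ c i′)
    pull q′ i′ = trans (*-distribʳ-sum (Y q′ i′) (λ c → when (does (x c Data.Fin.≟ q′)) (M c i′)))
                       (sum-cong-≋ {k} (λ c → when-*ʳ (does (x c Data.Fin.≟ q′)) (M c i′) (Y q′ i′)))

  idMat-apply : ∀ {r} (i : Fin r) (h : Fin r → Carrier) → sum (λ l → idMat 𝕂 i l * h l) ≈ h i
  idMat-apply i h = trans (sum-single i off-diagonal) (trans (*-congʳ (diagonal i)) (*-identityˡ (h i)))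
    where
    diagonal : ∀ i → idMat 𝕂 i i ≈ 1#
    diagonal i with i Data.Fin.≟ i
    ... | yes _  = refl
    ... | no i≢i = contradiction ≡.refl i≢i
    off-diagonal : ∀ l → l ≢ i → idMat 𝕂 i l * h l ≈ 0#
    off-diagonal l l≢i with i Data.Fin.≟ l
    ... | yes i≡l = contradiction (≡.sym i≡l) l≢i
    ... | no _    = zeroˡ (h l)

  vecMatVec-assoc : ∀ {r} (a : Fin r → Carrier) (B : Fin r → Fin r → Carrier) (v : Fin r → Carrier) →
                    sum (λ i → sum (λ l → a l * B l i) * v i) ≈ sum (λ l → a l * sum (λ i → B l i * v i))
  vecMatVec-assoc a B v = begin
    sum (λ i → sum (λ l → a l * B l i) * v i)  ≈⟨ sum-cong-≋ (λ i → *-distribʳ-sum (v i) (λ l → a l * B l i)) ⟩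
    sum (λ i → sum (λ l → a l * B l i * v i))  ≈⟨ ∑-comm (λ i l → a l * B l i * v i) ⟩
    sum (λ l → sum (λ i → a l * B l i * v i))  ≈⟨ sum-cong-≋ (λ l → sum-cong-≋ (λ i → *-assoc (a l) (B l i) (v i))) ⟩
    sum (λ l → sum (λ i → a l * (B l i * v i))) ≈⟨ sum-cong-≋ (λ l → sym (*-distribˡ-sum (a l) (λ i → B l i * v i))) ⟩
    sum (λ l → a l * sum (λ i → B l i * v i))  ∎

  module _ {A : Set} (R : LinRep 𝕂 A) where
    open LinRep R

    col : List A → Fin dim → Carrier
    col w i = sum (λ j → μ* 𝕂 R w i j * γ j)

    evalRep-col : ∀ w → evalRep 𝕂 R w ≈ sum (λ i → λv i * col w i)
    evalRep-col w = begin
      evalRep 𝕂 R w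
        ≈⟨ sumFin≈sum {dim} (λ i → sumFin≈sum {dim} (λ j → refl)) ⟩
      sum {dim} (λ i → sum {dim} (λ j → λv i * μ* 𝕂 R w i j * γ j))
        ≈⟨ sum-cong-≋ (λ i → trans (sum-cong-≋ (λ j → *-assoc (λv i) _ (γ j)))
                                   (sym (*-distribˡ-sum (λv i) (λ j → μ* 𝕂 R w i j * γ j)))) ⟩
      sum (λ i → λv i * col w i) ∎

    col-[] : ∀ i → col [] i ≈ γ i
    col-[] i = idMat-apply i γ

    col-∷ : ∀ a w i → col (a ∷ w) i ≈ sum (λ l → μ a i l * col w l)
    col-∷ a w i = trans (sum-cong-≋ {dim} (λ j → *-congʳ (sumFin≈sum {dim} (λ l → refl))))
                        (vecMatVec-assoc (μ a i) (μ* 𝕂 R w) γ)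

    col-++ : ∀ u v k → sum (λ i → μ* 𝕂 R u k i * col v i) ≈ col (u ++ v) k
    col-++ []      v k = idMat-apply k (col v)
    col-++ (a ∷ u) v k = begin
      sum (λ i → μ* 𝕂 R (a ∷ u) k i * col v i)
        ≈⟨ sum-cong-≋ {dim} (λ i → *-congʳ (sumFin≈sum {dim} (λ l → refl))) ⟩
      sum {dim} (λ i → sum {dim} (λ l → μ a k l * μ* 𝕂 R u l i) * col v i)
        ≈⟨ vecMatVec-assoc (μ a k) (μ* 𝕂 R u) (col v) ⟩
      sum (λ l → μ a k l * sum (λ i → μ* 𝕂 R u l i * col v i))
        ≈⟨ sum-cong-≋ (λ l → *-congˡ (col-++ u v l)) ⟩
      sum (λ l → μ a k l * col (u ++ v) l)
        ≈⟨ sym (col-∷ a (u ++ v) k) ⟩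
      col (a ∷ u ++ v) k ∎


module Words (k : ℕ) where

  open import Data.Nat using (zero; suc; _<_; _≤′_; ≤′-refl; ≤′-step; s≤s; z≤n)
  open import Data.Nat.Properties using (≤′⇒≤; ≤-reflexive; m≤n⇒m≤1+n; n≤0⇒n≡0; suc-injective; 1+n≰n; ≤-pred; ≤∧≢⇒<)
  open import Data.Fin using (Fin)
  open import Data.Product using (proj₁; proj₂)
  open import Function using (_∘_)
  open import Data.List using (List; []; _∷_; _++_; map; concatMap; upTo; allFin; length)
  open import Data.List.Properties using (concatMap-++; ++-identityʳ; upTo-∷ʳ)
  open import Data.List.Membership.Propositional using (_∈_)
  open import Data.List.Membership.Propositional.Properties using (∈-map⁺; ∈-++⁺ˡ; ∈-++⁺ʳ; ∈-concatMap⁺; ∈-allFin)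
  open import Data.List.Relation.Unary.Any as Any using (here)
  open import Relation.Binary.PropositionalEquality as ≡ using (_≡_; _≢_)
  open import Relation.Nullary using (yes; no)

  words : ℕ → List (List (Fin k))
  words = wordsOfLength k

  wordsUpTo : ℕ → List (List (Fin k))
  wordsUpTo m = concatMap words (upTo (suc m))

  wordsUpTo-suc : ∀ m → wordsUpTo (suc m) ≡ wordsUpTo m ++ words (suc m)
  wordsUpTo-suc m = begin
    concatMap words (upTo (suc (suc m)))      ≡⟨ ≡.cong (concatMap words) (≡.sym (upTo-∷ʳ (suc m))) ⟩
    concatMap words (upTo (suc m) ++ suc m ∷ []) ≡⟨ concatMap-++ words (upTo (suc m)) (suc m ∷ []) ⟩
    wordsUpTo m ++ (words (suc m) ++ [])     ≡⟨ ≡.cong (wordsUpTo m ++_) (++-identityʳ (words (suc m))) ⟩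
    wordsUpTo m ++ words (suc m)             ∎
    where open ≡.≡-Reasoning

  ∈-words : ∀ u → u ∈ words (length u)
  ∈-words []      = here ≡.refl
  ∈-words (a ∷ u) = ∈-concatMap⁺ _ (Any.map (λ { ≡.refl → ∈-map⁺ (a ∷_) (∈-words u) }) (∈-allFin a))

  ∈-wordsUpTo : ∀ m u → length u ≤ m → u ∈ wordsUpTo m
  ∈-wordsUpTo zero    [] z≤n = here ≡.refl
  ∈-wordsUpTo (suc m) u |u|≤1+m with length u Data.Nat.≟ suc m
  ... | yes |u|≡1+m = ≡.subst (u ∈_) (≡.sym (wordsUpTo-suc m))
                        (∈-++⁺ʳ (wordsUpTo m) (≡.subst (λ n → u ∈ words n) |u|≡1+m (∈-words u)))
  ... | no  |u|≢1+m = ≡.subst (u ∈_) (≡.sym (wordsUpTo-suc m))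
                        (∈-++⁺ˡ (∈-wordsUpTo m u (≤-pred (≤∧≢⇒< |u|≤1+m |u|≢1+m))))

  module _ {c ℓ} (𝕂 : Semiring c ℓ) where
    open Semiring 𝕂 hiding (zero)
    open SemiringSums 𝕂
    open import Data.List.Properties using (∷-injective)

    lsum-words-suc : ∀ n (F : List (Fin k) → Carrier) →
                     lsum (words (suc n)) F ≈ sum (λ a → lsum (words n) (F ∘ (a ∷_)))
    lsum-words-suc n F = trans (lsum-concatMap (λ a → map (a ∷_) (words n)) (allFin k) F) (trans
      (lsum-tabulate {n = k} (λ a → a) (λ a → lsum (map (a ∷_) (words n)) F))
      (sum-cong-≋ {k} (λ a → reflexive (lsum-map (a ∷_) (words n) F))))

    lsum-words-cong : ∀ n {F G : List (Fin k) → Carrier} → (∀ v → length v ≡ n → F v ≈ G v) →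
                      lsum (words n) F ≈ lsum (words n) G
    lsum-words-cong zero    F≈G = +-congʳ (F≈G [] ≡.refl)
    lsum-words-cong (suc n) {F} {G} F≈G = trans (lsum-words-suc n F) (trans
      (sum-cong-≋ (λ a → lsum-words-cong n (λ v |v|≡n → F≈G (a ∷ v) (≡.cong suc |v|≡n))))
      (sym (lsum-words-suc n G)))

    lsum-words-zero : ∀ n {F : List (Fin k) → Carrier} → (∀ v → length v ≡ n → F v ≈ 0#) → lsum (words n) F ≈ 0#
    lsum-words-zero n F≈0 = trans (lsum-words-cong n {G = λ _ → 0#} F≈0) (lsum-zero (words n))

    lsum-words-single : ∀ n {F : List (Fin k) → Carrier} u → length u ≡ n →
                        (∀ v → length v ≡ n → v ≢ u → F v ≈ 0#) → lsum (words n) F ≈ F u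
    lsum-words-single zero    []      _ _ = +-identityʳ _
    lsum-words-single (suc n) {F} (b ∷ u) |u|≡1+n F≈0 = trans (lsum-words-suc n F) (trans
      (sum-single b (λ a a≢b → lsum-words-zero n (λ v |v|≡n → F≈0 (a ∷ v) (≡.cong suc |v|≡n) (a≢b ∘ proj₁ ∘ ∷-injective))))
      (lsum-words-single n u (suc-injective |u|≡1+n) λ v |v|≡n v≢u →
         F≈0 (b ∷ v) (≡.cong suc |v|≡n) (v≢u ∘ proj₂ ∘ ∷-injective)))

    lsum-wordsUpTo-suc : ∀ m (F : List (Fin k) → Carrier) →
                         lsum (wordsUpTo (suc m)) F ≈ lsum (wordsUpTo m) F + lsum (words (suc m)) F
    lsum-wordsUpTo-suc m F =
      trans (reflexive (≡.cong (λ ws → lsum ws F) (wordsUpTo-suc m))) (lsum-++ (wordsUpTo m) (words (suc m)) F)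

    lsum-wordsUpTo-cong : ∀ m {F G : List (Fin k) → Carrier} → (∀ v → length v ≤ m → F v ≈ G v) →
                          lsum (wordsUpTo m) F ≈ lsum (wordsUpTo m) G
    lsum-wordsUpTo-cong zero    F≈G = (lsum-words-cong 0 (λ v |v|≡0 → F≈G v (≤-reflexive |v|≡0)))
    lsum-wordsUpTo-cong (suc m) {F} {G} F≈G = trans (lsum-wordsUpTo-suc m F) (trans
      (+-cong (lsum-wordsUpTo-cong m (λ v |v|≤m → F≈G v (m≤n⇒m≤1+n |v|≤m)))
              (lsum-words-cong (suc m) (λ v |v|≡1+m → F≈G v (≤-reflexive |v|≡1+m))))
      (sym (lsum-wordsUpTo-suc m G)))

    lsum-wordsUpTo-extend : ∀ {m m′} {F : List (Fin k) → Carrier} → m ≤′ m′ →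
                            (∀ v → m < length v → F v ≈ 0#) → lsum (wordsUpTo m′) F ≈ lsum (wordsUpTo m) F
    lsum-wordsUpTo-extend ≤′-refl _ = refl
    lsum-wordsUpTo-extend {m} {F = F} (≤′-step {m′} m≤′m′) F≈0 = trans (lsum-wordsUpTo-suc m′ F) (trans
      (+-congˡ (lsum-words-zero (suc m′) (λ v |v|≡1+m′ → F≈0 v (≡.subst (m <_) (≡.sym |v|≡1+m′) (s≤s (≤′⇒≤ m≤′m′))))))
      (trans (+-identityʳ _) (lsum-wordsUpTo-extend m≤′m′ F≈0)))

    lsum-wordsUpTo-zero : ∀ m {F : List (Fin k) → Carrier} → (∀ v → length v ≤ m → F v ≈ 0#) →
                          lsum (wordsUpTo m) F ≈ 0#
    lsum-wordsUpTo-zero m F≈0 = trans (lsum-wordsUpTo-cong m {G = λ _ → 0#} F≈0) (lsum-zero (wordsUpTo m))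

    lsum-wordsUpTo-single : ∀ m {F : List (Fin k) → Carrier} u → length u ≤ m →
                            (∀ v → length v ≤ m → v ≢ u → F v ≈ 0#) → lsum (wordsUpTo m) F ≈ F u
    lsum-wordsUpTo-single zero u |u|≤0 F≈0 =
      (lsum-words-single 0 u (n≤0⇒n≡0 |u|≤0) (λ v |v|≡0 → F≈0 v (≤-reflexive |v|≡0)))
    lsum-wordsUpTo-single (suc m) {F} u |u|≤1+m F≈0 with length u Data.Nat.≟ suc m
    ... | yes |u|≡1+m = trans (lsum-wordsUpTo-suc m F) (trans
      (+-cong (lsum-wordsUpTo-zero m (λ v |v|≤m → F≈0 v (m≤n⇒m≤1+n |v|≤m)
                                      λ { ≡.refl → 1+n≰n (≡.subst (_≤ m) |u|≡1+m |v|≤m) }))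
              (lsum-words-single (suc m) u |u|≡1+m (λ v |v|≡1+m → F≈0 v (≤-reflexive |v|≡1+m))))
      (+-identityˡ _))
    ... | no  |u|≢1+m = trans (lsum-wordsUpTo-suc m F) (trans
      (+-cong (lsum-wordsUpTo-single m u |u|≤m (λ v |v|≤m → F≈0 v (m≤n⇒m≤1+n |v|≤m)))
              (lsum-words-zero (suc m) (λ v |v|≡1+m → F≈0 v (≤-reflexive |v|≡1+m) λ { ≡.refl → |u|≢1+m |v|≡1+m })))
      (+-identityʳ _))
      where |u|≤m = ≤-pred (≤∧≢⇒< |u|≤1+m |u|≢1+m)

module Radix (k : ℕ) where

  open import Data.Nat using (_<_; _<ᵇ_; _≡ᵇ_)
  open import Data.Nat.Properties
    using (<ᵇ⇒<; <⇒<ᵇ; ≡ᵇ⇒≡; ≡⇒≡ᵇ; <-irrefl; <-trans; <-≤-trans; <⇒≤; ≤-reflexive; <-cmp; suc-injective)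
  open import Data.Bool using (T; _∧_; _∨_)
  open import Data.Bool.Properties using (T-∨; T-∧)
  open import Data.Fin using (Fin; toℕ)
  open import Data.Fin.Properties using (toℕ-injective)
  open import Data.List using (List; []; _∷_; length)
  open import Data.Product using (_×_; _,_)
  open import Data.Sum using (_⊎_; inj₁; inj₂)
  open import Function.Bundles using (Equivalence)
  open import Relation.Binary using (tri<; tri≈; tri>)
  open import Relation.Binary.PropositionalEquality as ≡ using (_≡_; _≢_)
  open import Relation.Nullary using (¬_)
  open import Function using (_∘_)
  open Equivalence using (to; from)

  -- lexLt on a nonempty pair and radixLt both have the shape
  -- (m <ᵇ n) ∨ ((m ≡ᵇ n) ∧ b): compare a key first, break ties by b.
  T-keyThen : ∀ {m n b} → T ((m <ᵇ n) ∨ ((m ≡ᵇ n) ∧ b)) → m < n ⊎ (m ≡ n × T b)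
  T-keyThen {m} {n} h with to T-∨ h
  ... | inj₁ m<n = inj₁ (<ᵇ⇒< m n m<n)
  ... | inj₂ tie with to T-∧ tie
  ...   | m≡n , b = inj₂ (≡ᵇ⇒≡ m n m≡n , b)

  keyThen-< : ∀ {m n b} → m < n → T ((m <ᵇ n) ∨ ((m ≡ᵇ n) ∧ b))
  keyThen-< m<n = from T-∨ (inj₁ (<⇒<ᵇ m<n))

  keyThen-≡ : ∀ {m n b} → m ≡ n → T b → T ((m <ᵇ n) ∨ ((m ≡ᵇ n) ∧ b))
  keyThen-≡ {m} {n} m≡n b = from T-∨ (inj₂ (from T-∧ (≡⇒≡ᵇ m n m≡n , b)))

  Word′ : Set
  Word′ = List (Fin k)

  record _<ˡ_ (u v : Word′) : Set where
    constructor lex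
    field lexLt-holds : T (lexLt u v)

  record _<ʳ_ (u v : Word′) : Set where
    constructor radix
    field radixLt-holds : T (radixLt u v)

  lex⁻ : ∀ {a b u v} → (a ∷ u) <ˡ (b ∷ v) → toℕ a < toℕ b ⊎ (toℕ a ≡ toℕ b × u <ˡ v)
  lex⁻ (lex h) with T-keyThen h
  ... | inj₁ a<b         = inj₁ a<b
  ... | inj₂ (a≡b , u<v) = inj₂ (a≡b , lex u<v)

  lex⁺-< : ∀ {a b} u v → toℕ a < toℕ b → (a ∷ u) <ˡ (b ∷ v)
  lex⁺-< u v a<b = lex (keyThen-< a<b)

  lex⁺-≡ : ∀ {a b u v} → toℕ a ≡ toℕ b → u <ˡ v → (a ∷ u) <ˡ (b ∷ v)
  lex⁺-≡ a≡b (lex u<v) = lex (keyThen-≡ a≡b u<v)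

  radix⁻ : ∀ {u v} → u <ʳ v → length u < length v ⊎ (length u ≡ length v × u <ˡ v)
  radix⁻ (radix h) with T-keyThen h
  ... | inj₁ |u|<|v|         = inj₁ |u|<|v|
  ... | inj₂ (|u|≡|v| , u<v) = inj₂ (|u|≡|v| , lex u<v)

  radix⁺-< : ∀ {u v} → length u < length v → u <ʳ v
  radix⁺-< |u|<|v| = radix (keyThen-< |u|<|v|)

  radix⁺-≡ : ∀ {u v} → length u ≡ length v → u <ˡ v → u <ʳ v
  radix⁺-≡ |u|≡|v| (lex u<v) = radix (keyThen-≡ |u|≡|v| u<v)

  lex-irrefl : ∀ u → ¬ u <ˡ u
  lex-irrefl (a ∷ u) h with lex⁻ h
  ... | inj₁ a<a      = <-irrefl ≡.refl a<a
  ... | inj₂ (_ , u<u) = lex-irrefl u u<u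

  lex-trans : ∀ u v w → u <ˡ v → v <ˡ w → u <ˡ w
  lex-trans (a ∷ u) (b ∷ v) (c ∷ w) h₁ h₂ with lex⁻ h₁ | lex⁻ h₂
  ... | inj₁ a<b         | inj₁ b<c         = lex⁺-< u w (<-trans a<b b<c)
  ... | inj₁ a<b         | inj₂ (b≡c , _)   = lex⁺-< u w (≡.subst (toℕ a <_) b≡c a<b)
  ... | inj₂ (a≡b , _)   | inj₁ b<c         = lex⁺-< u w (≡.subst (_< toℕ c) (≡.sym a≡b) b<c)
  ... | inj₂ (a≡b , u<v) | inj₂ (b≡c , v<w) = lex⁺-≡ (≡.trans a≡b b≡c) (lex-trans u v w u<v v<w)

  lex-total : ∀ u v → length u ≡ length v → u ≢ v → u <ˡ v ⊎ v <ˡ u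
  lex-total []      []      _   u≢v = ⊥-elim (u≢v ≡.refl)
    where open import Data.Empty using (⊥-elim)
  lex-total (a ∷ u) (b ∷ v) |u|≡|v| u≢v with <-cmp (toℕ a) (toℕ b)
  ... | tri< a<b _ _ = inj₁ (lex⁺-< u v a<b)
  ... | tri> _ _ b<a = inj₂ (lex⁺-< v u b<a)
  ... | tri≈ _ a≡b _ with toℕ-injective a≡b
  ...   | ≡.refl with lex-total u v (suc-injective |u|≡|v|) (u≢v ∘ ≡.cong (a ∷_))
  ...     | inj₁ u<v = inj₁ (lex⁺-≡ ≡.refl u<v)
  ...     | inj₂ v<u = inj₂ (lex⁺-≡ ≡.refl v<u)

  radix-irrefl : ∀ u → ¬ u <ʳ u
  radix-irrefl u h with radix⁻ h
  ... | inj₁ |u|<|u|   = <-irrefl ≡.refl |u|<|u|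
  ... | inj₂ (_ , u<u) = lex-irrefl u u<u

  radix-length : ∀ {u v} → u <ʳ v → length u ≤ length v
  radix-length h with radix⁻ h
  ... | inj₁ |u|<|v|     = <⇒≤ |u|<|v|
  ... | inj₂ (|u|≡|v| , _) = ≤-reflexive |u|≡|v|

  radix-trans : ∀ {u v w} → u <ʳ v → v <ʳ w → u <ʳ w
  radix-trans {u} {v} {w} h₁ h₂ with radix⁻ h₁ | radix⁻ h₂
  ... | inj₁ |u|<|v|         | _                    = radix⁺-< (<-≤-trans |u|<|v| (radix-length h₂))
  ... | inj₂ (|u|≡|v| , _)   | inj₁ |v|<|w|         = radix⁺-< (≡.subst (_< length w) (≡.sym |u|≡|v|) |v|<|w|)
  ... | inj₂ (|u|≡|v| , u<v) | inj₂ (|v|≡|w| , v<w) = radix⁺-≡ (≡.trans |u|≡|v| |v|≡|w|) (lex-trans u v w u<v v<w)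

  radix-total : ∀ u v → u ≢ v → u <ʳ v ⊎ v <ʳ u
  radix-total u v u≢v with <-cmp (length u) (length v)
  ... | tri< |u|<|v| _ _ = inj₁ (radix⁺-< |u|<|v|)
  ... | tri> _ _ |v|<|u| = inj₂ (radix⁺-< |v|<|u|)
  ... | tri≈ _ |u|≡|v| _ with lex-total u v |u|≡|v| u≢v
  ...   | inj₁ u<v = inj₁ (radix⁺-≡ |u|≡|v| u<v)
  ...   | inj₂ v<u = inj₂ (radix⁺-≡ (≡.sym |u|≡|v|) v<u)

module Values (S : ANS) where

  open import Data.Nat using (zero; suc; _+_; _<_; z≤n)
  open import Data.Nat.Properties as ℕ using (+-*-semiring)
  open import Data.Nat.ListAction using () renaming (sum to sumℕ)
  open import Data.Bool using (false; T; _∧_; if_then_else_)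
  open import Data.Bool.Properties using (T?)
  open import Data.Fin using (Fin)
  import Data.Fin as Fin
  open import Data.List using (List; []; _∷_; map; length)
  open import Data.List.Properties using (≡-dec)
  open import Data.List.Membership.Propositional using (_∈_; lose)
  open import Data.List.Relation.Unary.Any as Any using (Any; here; there; any?)
  open import Data.Sum using (inj₁; inj₂)
  open import Relation.Nullary using (_×-dec_; contradiction)
  import Relation.Nullary.Decidable as Dec
  open import Relation.Unary using (Pred; Decidable)
  open import Relation.Binary.PropositionalEquality as ≡ using (_≡_; _≢_)
  open Radix (ANS.alph S)
  open Words (ANS.alph S)
  open SemiringSums +-*-semiring using (lsum; lsum-+)

  _≟ʷ_ : (u v : Word′) → Dec (u ≡ v)
  _≟ʷ_ = ≡-dec Fin._≟_

  _<ʳ?_ : (u v : Word′) → Dec (u <ʳ v)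
  u <ʳ? v = Dec.map′ radix _<ʳ_.radixLt-holds (T? (radixLt u v))

  InL? : (u : Word′) → Dec (InL S u)
  InL? u = accepts (ANS.dfa S) u Data.Bool.≟ true

  lsum-mono : ∀ {X : Set} (xs : List X) {f g : X → ℕ} → (∀ x → f x ≤ g x) → lsum xs f ≤ lsum xs g
  lsum-mono []       f≤g = z≤n
  lsum-mono (x ∷ xs) f≤g = ℕ.+-mono-≤ (f≤g x) (lsum-mono xs f≤g)

  sumℕ-map : ∀ {X : Set} (f : X → ℕ) xs → sumℕ (map f xs) ≡ lsum xs f
  sumℕ-map f []       = ≡.refl
  sumℕ-map f (x ∷ xs) = ≡.cong (f x +_) (sumℕ-map f xs)

  counts : Word′ → Word′ → ℕ
  counts u v = if accepts (ANS.dfa S) v ∧ radixLt v u then 1 else 0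

  data CountsView (u v : Word′) : ℕ → Set where
    counted : InL S v → v <ʳ u → CountsView u v 1
    skipped : ¬ (InL S v × v <ʳ u) → CountsView u v 0

  counts-view : ∀ u v → CountsView u v (counts u v)
  counts-view u v with accepts (ANS.dfa S) v in v∈L | radixLt v u in v<u
  ... | false | _     = skipped λ { (v∈L′ , _) → contradiction (≡.trans (≡.sym v∈L) v∈L′) λ () }
  ... | true  | true  = counted v∈L (radix (≡.subst T (≡.sym v<u) _))
  ... | true  | false = skipped λ { (_ , radix h) → ≡.subst T v<u h }

  countBelow : ℕ → Word′ → ℕ
  countBelow m u = lsum (wordsUpTo m) (counts u)

  countBelow-val : ∀ {m} u → length u ≤ m → countBelow m u ≡ val S u
  countBelow-val u |u|≤m = ≡.trans (lsum-wordsUpTo-extend +-*-semiring {F = counts u} (ℕ.≤⇒≤′ |u|≤m) counts-longer)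
                                    (≡.sym (sumℕ-map (counts u) (wordsUpTo (length u))))
    where
    counts-longer : ∀ v → length u < length v → counts u v ≡ 0
    counts-longer v |u|<|v| with counts u v | counts-view u v
    ... | _ | counted _ v<u = contradiction (radix-length v<u) (ℕ.<⇒≱ |u|<|v|)
    ... | _ | skipped _     = ≡.refl

  indicator : Word′ → Word′ → ℕ
  indicator u v = if Dec.does (v ≟ʷ u) then 1 else 0

  lsum-indicator : ∀ {m} u → length u ≤ m → lsum (wordsUpTo m) (indicator u) ≡ 1
  lsum-indicator {m} u |u|≤m = ≡.trans (lsum-wordsUpTo-single +-*-semiring m u |u|≤m off) on
    where
    off : ∀ v → length v ≤ m → v ≢ u → indicator u v ≡ 0
    off v _ v≢u with v ≟ʷ u
    ... | yes v≡u = contradiction v≡u v≢u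
    ... | no  _   = ≡.refl
    on : indicator u u ≡ 1
    on with u ≟ʷ u
    ... | yes _   = ≡.refl
    ... | no  u≢u = contradiction ≡.refl u≢u

  val-+1 : ∀ {m} u → length u ≤ m → suc (val S u) ≡ lsum (wordsUpTo m) (λ v → counts u v + indicator u v)
  val-+1 {m} u |u|≤m = begin
    suc (val S u)                                 ≡⟨ ≡.cong suc (≡.sym (countBelow-val u |u|≤m)) ⟩
    suc (countBelow m u)                          ≡⟨ ℕ.+-comm 1 _ ⟩
    countBelow m u + 1                            ≡⟨ ≡.cong (countBelow m u +_) (≡.sym (lsum-indicator u |u|≤m)) ⟩
    countBelow m u + lsum (wordsUpTo m) (indicator u) ≡⟨ ≡.sym (lsum-+ (wordsUpTo m) (counts u) (indicator u)) ⟩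
    lsum (wordsUpTo m) (λ v → counts u v + indicator u v) ∎
    where open ≡.≡-Reasoning

  counts-self : ∀ u → counts u u ≡ 0
  counts-self u with counts u u | counts-view u u
  ... | _ | counted _ u<u = contradiction u<u (radix-irrefl u)
  ... | _ | skipped _     = ≡.refl

  counts-+1 : ∀ {u u′} → InL S u → u <ʳ u′ → ∀ v → counts u v + indicator u v ≤ counts u′ v
  counts-+1 {u} {u′} u∈L u<u′ v with v ≟ʷ u
  ... | yes ≡.refl rewrite counts-self u with counts u′ u | counts-view u′ u
  ...   | _ | counted _ _ = ℕ.≤-refl
  ...   | _ | skipped ¬c  = contradiction (u∈L , u<u′) ¬c
  counts-+1 {u} {u′} u∈L u<u′ v | no _ with counts u v | counts-view u v | counts u′ v | counts-view u′ v
  ... | _ | skipped _       | _ | _           = z≤n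
  ... | _ | counted _ _     | _ | counted _ _ = ℕ.≤-refl
  ... | _ | counted v∈L v<u | _ | skipped ¬c  = contradiction (v∈L , radix-trans v<u u<u′) ¬c

  val-< : ∀ {u u′} → InL S u → u <ʳ u′ → val S u < val S u′
  val-< {u} {u′} u∈L u<u′ = ℕ.≤-trans (ℕ.≤-reflexive (val-+1 u (radix-length u<u′)))
    (ℕ.≤-trans (lsum-mono (wordsUpTo (length u′)) (counts-+1 u∈L u<u′)) (ℕ.≤-reflexive (countBelow-val u′ ℕ.≤-refl)))

  val-injective : ∀ {u u′} → InL S u → InL S u′ → val S u ≡ val S u′ → u ≡ u′
  val-injective {u} {u′} u∈L u′∈L eq with u ≟ʷ u′
  ... | yes u≡u′ = u≡u′
  ... | no  u≢u′ with radix-total u u′ u≢u′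
  ...   | inj₁ u<u′ = contradiction eq (ℕ.<⇒≢ (val-< u∈L u<u′))
  ...   | inj₂ u′<u = contradiction (≡.sym eq) (ℕ.<⇒≢ (val-< u′∈L u′<u))

  Least : ∀ {p} → Pred Word′ p → Word′ → Set p
  Least P x = P x × (∀ y → P y → ¬ y <ʳ x)

  least-in : ∀ {p} {P : Pred Word′ p} → Decidable P → ∀ xs → Any P xs →
             Σ Word′ λ x → x ∈ xs × P x × (∀ y → y ∈ xs → P y → ¬ y <ʳ x)
  least-in P? (x ∷ xs) some with P? x
  ... | no ¬px with least-in P? xs (Any.tail ¬px some)
  ...   | m , m∈xs , pm , m-least = m , there m∈xs , pm , λ
    { y (here ≡.refl) py → contradiction py ¬px
    ; y (there y∈xs) py → m-least y y∈xs py }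
  least-in P? (x ∷ xs) some | yes px with any? P? xs
  ...   | no none = x , here ≡.refl , px , λ
    { y (here ≡.refl) _ → radix-irrefl y
    ; y (there y∈xs) py → contradiction (lose y∈xs py) none }
  ...   | yes some′ with least-in P? xs some′
  ...     | m , m∈xs , pm , m-least with x <ʳ? m
  ...       | yes x<m = x , here ≡.refl , px , λ
    { y (here ≡.refl) _       → radix-irrefl y
    ; y (there y∈xs) py y<x → m-least y y∈xs py (radix-trans y<x x<m) }
  ...       | no  x≮m = m , there m∈xs , pm , λ
    { y (here ≡.refl) _ → x≮m
    ; y (there y∈xs) py → m-least y y∈xs py }

  -- The least element among the finitely many words of length ≤ |v| is
  -- least overall, since any word radix-below it is no longer than v.
  least : ∀ {p} {P : Pred Word′ p} → Decidable P → ∀ v → P v → Σ Word′ (Least P)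
  least P? v pv with least-in P? (wordsUpTo (length v)) (lose (∈-wordsUpTo (length v) v ℕ.≤-refl) pv)
  ... | x , _ , px , x-least =
    x , px , λ y py y<x → x-least y (∈-wordsUpTo (length v) y (ℕ.≤-trans (radix-length y<x) |x|≤|v|)) py y<x
    where
    v∈ = ∈-wordsUpTo (length v) v ℕ.≤-refl
    |x|≤|v| : length x ≤ length v
    |x|≤|v| with x ≟ʷ v
    ... | yes ≡.refl = ℕ.≤-refl
    ... | no  x≢v with radix-total x v x≢v
    ...   | inj₁ x<v = radix-length x<v
    ...   | inj₂ v<x = contradiction v<x (x-least v v∈ pv)

  counts-successor : ∀ {u u′} → InL S u → u <ʳ u′ → (∀ y → InL S y → u <ʳ y → ¬ y <ʳ u′) →
                     ∀ v → counts u′ v ≡ counts u v + indicator u v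
  counts-successor {u} {u′} u∈L u<u′ u′-next v with v ≟ʷ u
  ... | yes ≡.refl rewrite counts-self u with counts u′ u | counts-view u′ u
  ...   | _ | counted _ _ = ≡.refl
  ...   | _ | skipped ¬c  = contradiction (u∈L , u<u′) ¬c
  counts-successor {u} {u′} u∈L u<u′ u′-next v | no v≢u
    with counts u v | counts-view u v | counts u′ v | counts-view u′ v
  ... | _ | skipped _       | _ | skipped _      = ≡.refl
  ... | _ | counted _ _     | _ | counted _ _    = ≡.refl
  ... | _ | counted v∈L v<u | _ | skipped ¬c     = contradiction (v∈L , radix-trans v<u u<u′) ¬c
  ... | _ | skipped ¬c      | _ | counted v∈L v<u′ with radix-total v u v≢u
  ...   | inj₁ v<u = contradiction (v∈L , v<u) ¬c
  ...   | inj₂ u<v = contradiction v<u′ (u′-next v v∈L u<v)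

  val-surjective : ∀ n → Σ Word′ λ u → InL S u × val S u ≡ n
  val-surjective zero with ANS.infinite S 0
  ... | v , _ , v∈L with least InL? v v∈L
  ...   | u , u∈L , u-least = u , u∈L , ≡.trans (sumℕ-map (counts u) (wordsUpTo (length u)))
                                          (lsum-wordsUpTo-zero +-*-semiring (length u) nothing-below)
    where
    nothing-below : ∀ v → length v ≤ length u → counts u v ≡ 0
    nothing-below v _ with counts u v | counts-view u v
    ... | _ | counted v∈L v<u = contradiction v<u (u-least v v∈L)
    ... | _ | skipped _       = ≡.refl
  val-surjective (suc n) with val-surjective n
  ... | u , u∈L , val-u with ANS.infinite S (suc (length u))
  ...   | v , |u|<|v| , v∈L with least (λ y → InL? y ×-dec u <ʳ? y) v (v∈L , radix⁺-< |u|<|v|)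
  ...     | u′ , (u′∈L , u<u′) , u′-least = u′ , u′∈L , (begin
    val S u′                                            ≡⟨ ≡.sym (countBelow-val u′ ℕ.≤-refl) ⟩
    lsum (wordsUpTo (length u′)) (counts u′)
      ≡⟨ lsum-wordsUpTo-cong +-*-semiring (length u′) (λ w _ → counts-successor u∈L u<u′ u′-next w) ⟩
    lsum (wordsUpTo (length u′)) (λ w → counts u w + indicator u w) ≡⟨ ≡.sym (val-+1 u (radix-length u<u′)) ⟩
    suc (val S u)                                       ≡⟨ ≡.cong suc val-u ⟩
    suc n                                               ∎)
    where
    open ≡.≡-Reasoning
    u′-next : ∀ y → InL S y → u <ʳ y → ¬ y <ʳ u′
    u′-next y y∈L u<y = u′-least y (y∈L , u<y)

nothing? : ∀ {X : Set} (m : Maybe X) → Dec (m ≡ nothing)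
nothing? nothing  = yes ≡.refl
nothing? (just _) = no λ ()

module Padding {X : Set} where

  open import Data.Nat using (zero; suc; _+_; _∸_; _≤?_)
  open import Data.Nat.Properties as ℕ using ()
  open import Data.Maybe using (Maybe; just; nothing)
  open import Data.List using (List; []; _∷_; _++_; map; replicate; length; catMaybes; drop)
  open import Data.List.Properties using (length-map; ∷-injective)
  open import Relation.Nullary using (yes; no; contradiction)

  pad : ℕ → List X → List (Maybe X)
  pad n u = replicate (n ∸ length u) nothing ++ map just u

  length-padded : ∀ a (u : List X) → length (replicate a nothing ++ map just u) ≡ a + length u
  length-padded zero    u = length-map just u
  length-padded (suc a) u = ≡.cong suc (length-padded a u)

  catMaybes-padded : ∀ a (u : List X) → catMaybes (replicate a nothing ++ map just u) ≡ u
  catMaybes-padded (suc a) u        = catMaybes-padded a u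
  catMaybes-padded zero    []       = ≡.refl
  catMaybes-padded zero    (x ∷ u) = ≡.cong (x ∷_) (catMaybes-padded zero u)

  padded-injective : ∀ a b {u v : List X} → replicate a nothing ++ map just u ≡ replicate b nothing ++ map just v → u ≡ v
  padded-injective a b {u} {v} eq =
    ≡.trans (≡.sym (catMaybes-padded a u)) (≡.trans (≡.cong catMaybes eq) (catMaybes-padded b v))

  replicate-+ : ∀ a b (t : List (Maybe X)) → replicate a nothing ++ (replicate b nothing ++ t) ≡ replicate (a + b) nothing ++ t
  replicate-+ zero    b t = ≡.refl
  replicate-+ (suc a) b t = ≡.cong (nothing ∷_) (replicate-+ a b t)

  map-just-tail : ∀ {m : Maybe X} {t u} → m ∷ t ≡ map just u → t ≡ map just (drop 1 u)
  map-just-tail {u = x ∷ u} eq = proj₂ (∷-injective eq)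

  nonblank-head : ∀ {m : Maybe X} {t} a {v : List X} → m ≢ nothing → m ∷ t ≡ replicate a nothing ++ map just v → a ≡ 0
  nonblank-head zero    _   _  = ≡.refl
  nonblank-head (suc a) m≢# eq = contradiction (proj₁ (∷-injective eq)) m≢#

  pad-shift : ∀ a {n} {u : List X} → length u ≤ n → replicate a nothing ++ pad n u ≡ pad (a + n) u
  pad-shift a {n} {u} |u|≤n = ≡.trans (replicate-+ a (n ∸ length u) (map just u))
                                      (≡.cong (λ k → replicate k nothing ++ map just u) (≡.sym (ℕ.+-∸-assoc a |u|≤n)))

  unpad : ∀ m a (t : List (Maybe X)) (u : List X) →
          replicate m nothing ++ t ≡ replicate a nothing ++ map just u → t ≡ pad (length t) u
  unpad zero    a       t u eq = ≡.subst (λ n → t ≡ replicate n nothing ++ map just u) a≡ eq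
    where
    a≡ : a ≡ length t ∸ length u
    a≡ = ≡.sym (≡.trans (≡.cong (_∸ length u) (≡.trans (≡.cong length eq) (length-padded a u))) (ℕ.m+n∸n≡m a (length u)))
  unpad (suc m) (suc a) t u eq = unpad m a t u (≡.cong (drop 1) eq)
  unpad (suc m) zero    t (x ∷ u) ()

  pad-tail : ∀ n {t : List (Maybe X)} {u : List X} → nothing ∷ t ≡ pad (suc n) u → t ≡ pad n u
  pad-tail n {t} {u} eq with length u ≤? n
  ... | yes |u|≤n = ≡.cong (drop 1) (≡.trans eq (≡.cong (λ a → replicate a nothing ++ map just u) (ℕ.+-∸-assoc 1 |u|≤n)))
  ... | no  |u|≰n = contradiction eq (head-mismatch (suc n ∸ length u) (ℕ.m≤n⇒m∸n≡0 (ℕ.≰⇒> |u|≰n)) u)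
    where
    head-mismatch : ∀ a → a ≡ 0 → ∀ (u : List X) → nothing ∷ t ≢ replicate a nothing ++ map just u
    head-mismatch zero _ (x ∷ u) ()

Fam : (ANS → Set) → ∀ {e} → System e → Set
Fam F {e} T = (j : Fin e) → F (lookup T j)

valT-cong : ∀ {e} (T : System e) {us us′ : Fam Word T} → (∀ j → us j ≡ us′ j) → valT T us ≡ valT T us′
valT-cong T eq = tabulate-cong (λ j → ≡.cong (val (lookup T j)) (eq j))
  where open import Data.Vec.Properties using (tabulate-cong)

valT-surjective : ∀ {e} (T : System e) n → Σ (Fam Word T) λ us → (∀ j → InL (lookup T j) (us j)) × valT T us ≡ n
valT-surjective T n = (λ j → proj₁ (preimage j)) , (λ j → proj₁ (proj₂ (preimage j))) ,
                      ≡.trans (tabulate-cong (λ j → proj₂ (proj₂ (preimage j)))) (tabulate∘lookup n)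
  where
  open import Data.Vec.Properties using (tabulate-cong; tabulate∘lookup)
  preimage = λ j → Values.val-surjective (lookup T j) (lookup n j)

valT-injective : ∀ {e} (T : System e) {us us′ : Fam Word T} →
                 (∀ j → InL (lookup T j) (us j)) → (∀ j → InL (lookup T j) (us′ j)) →
                 valT T us ≡ valT T us′ → ∀ j → us j ≡ us′ j
valT-injective T us∈L us′∈L eq j = Values.val-injective (lookup T j) (us∈L j) (us′∈L j)
  (≡.trans (≡.sym (lookup∘tabulate _ j)) (≡.trans (≡.cong (λ v → lookup v j) eq) (lookup∘tabulate _ j)))
  where open import Data.Vec.Properties using (lookup∘tabulate)

module Concat {d′ : ℕ} (S′ : System d′) where

  open import Data.Fin using (zero; suc)
  open import Data.List using (List; map)
  open import Data.Vec using ([]; _∷_)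
  import Data.Vec as Vec

  left : ∀ F {d} (S : System d) → Fam F (S ⊕ S′) → Fam F S
  left F (A ∷ S) t zero    = t zero
  left F (A ∷ S) t (suc i) = left F S (t ∘ suc) i

  right : ∀ F {d} (S : System d) → Fam F (S ⊕ S′) → Fam F S′
  right F []      t = t
  right F (A ∷ S) t = right F S (t ∘ suc)

  join : ∀ F {d} (S : System d) → Fam F S → Fam F S′ → Fam F (S ⊕ S′)
  join F []      a b = b
  join F (A ∷ S) a b zero    = a zero
  join F (A ∷ S) a b (suc J) = join F S (a ∘ suc) b J

  left-join : ∀ F {d} (S : System d) a b i → left F S (join F S a b) i ≡ a i
  left-join F (A ∷ S) a b zero    = ≡.refl
  left-join F (A ∷ S) a b (suc i) = left-join F S (a ∘ suc) b i

  right-join : ∀ F {d} (S : System d) a b j → right F S (join F S a b) j ≡ b j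
  right-join F []      a b j = ≡.refl
  right-join F (A ∷ S) a b j = right-join F S (a ∘ suc) b j

  module _ {F G : ANS → Set} (Q : ∀ A → F A → G A → Set) where

    left-pointwise : ∀ {d} (S : System d) {t s} → (∀ J → Q _ (t J) (s J)) → ∀ i → Q _ (left F S t i) (left G S s i)
    left-pointwise (A ∷ S) q zero    = q zero
    left-pointwise (A ∷ S) q (suc i) = left-pointwise S (q ∘ suc) i

    right-pointwise : ∀ {d} (S : System d) {t s} → (∀ J → Q _ (t J) (s J)) → ∀ j → Q _ (right F S t j) (right G S s j)
    right-pointwise []      q = q
    right-pointwise (A ∷ S) q = right-pointwise S (q ∘ suc)

    join-pointwise : ∀ {d} (S : System d) {t s} → (∀ i → Q _ (left F S t i) (left G S s i)) →
                     (∀ j → Q _ (right F S t j) (right G S s j)) → ∀ J → Q _ (t J) (s J)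
    join-pointwise []      ql qr J       = qr J
    join-pointwise (A ∷ S) ql qr zero    = ql zero
    join-pointwise (A ∷ S) ql qr (suc J) = join-pointwise S (ql ∘ suc) qr J

  left-map : ∀ F {X : Set} {d} (S : System d) (h : X → Fam F (S ⊕ S′)) xs i →
             left (List ∘ F) S (λ J → map (λ x → h x J) xs) i ≡ map (λ x → left F S (h x) i) xs
  left-map F (A ∷ S) h xs zero    = ≡.refl
  left-map F (A ∷ S) h xs (suc i) = left-map F S (λ x → h x ∘ suc) xs i

  right-map : ∀ F {X : Set} {d} (S : System d) (h : X → Fam F (S ⊕ S′)) xs j →
              right (List ∘ F) S (λ J → map (λ x → h x J) xs) j ≡ map (λ x → right F S (h x) j) xs
  right-map F []      h xs j = ≡.refl
  right-map F (A ∷ S) h xs j = right-map F S (λ x → h x ∘ suc) xs j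

  valT-join : ∀ {d} (S : System d) us vs → valT (S ⊕ S′) (join Word S us vs) ≡ valT S us Vec.++ valT S′ vs
  valT-join []      us vs = ≡.refl
  valT-join (A ∷ S) us vs = ≡.cong (val A (us zero) ∷_) (valT-join S (us ∘ suc) vs)

  valT-⊕ : ∀ {d} (S : System d) tt → valT (S ⊕ S′) tt ≡ valT S (left Word S tt) Vec.++ valT S′ (right Word S tt)
  valT-⊕ []      tt = ≡.refl
  valT-⊕ (A ∷ S) tt = ≡.cong (val A (tt zero) ∷_) (valT-⊕ S (tt ∘ suc))

module Maximum where

  open import Data.Nat using (zero; suc; _⊔_)
  open import Data.Nat.Properties using (≤-trans; ≤-reflexive; m≤m⊔n; m≤n⊔m; ⊔-sel; n≤0⇒n≡0)
  open import Data.Fin using (zero; suc)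
  open import Data.Sum using (_⊎_; inj₁; inj₂)

  maxOver : ∀ {e} → (Fin e → ℕ) → ℕ
  maxOver {zero}  h = 0
  maxOver {suc e} h = h zero ⊔ maxOver (h ∘ suc)

  ≤-maxOver : ∀ {e} (h : Fin e → ℕ) j → h j ≤ maxOver h
  ≤-maxOver h zero    = m≤m⊔n _ _
  ≤-maxOver h (suc j) = ≤-trans (≤-maxOver (h ∘ suc) j) (m≤n⊔m _ _)

  maxOver-attained : ∀ {e} (h : Fin e → ℕ) → maxOver h ≡ 0 ⊎ Σ (Fin e) λ j → maxOver h ≡ h j
  maxOver-attained {zero}  h = inj₁ ≡.refl
  maxOver-attained {suc e} h with ⊔-sel (h zero) (maxOver (h ∘ suc)) | maxOver-attained (h ∘ suc)
  ... | inj₁ max≡h₀ | _               = inj₂ (zero , max≡h₀)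
  ... | inj₂ max≡   | inj₁ rest≡0      = inj₁ (≡.trans max≡ rest≡0)
  ... | inj₂ max≡   | inj₂ (j , rest≡) = inj₂ (suc j , ≡.trans max≡ rest≡)

  ⊔-maxOver-attained : ∀ {e} a (h : Fin e → ℕ) → a ⊔ maxOver h ≡ a ⊎ Σ (Fin e) λ j → a ⊔ maxOver h ≡ h j
  ⊔-maxOver-attained a h with ⊔-sel a (maxOver h) | maxOver-attained h
  ... | inj₁ ≡a | _              = inj₁ ≡a
  ... | inj₂ ≡M | inj₁ M≡0       =
    inj₁ (≡.trans ≡M (≡.trans M≡0 (≡.sym (n≤0⇒n≡0 (≤-trans (m≤m⊔n a _) (≤-reflexive (≡.trans ≡M M≡0)))))))
  ... | inj₂ ≡M | inj₂ (j , M≡) = inj₂ (j , ≡.trans ≡M M≡)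

module Encodings {e : ℕ} (T : System e) where

  open import Data.Nat using (suc; _∸_; z≤n)
  open import Data.Nat.Properties as ℕ using ()
  open import Data.Fin.Properties using (¬∀⟶∃¬)
  open import Data.List using ([]; _∷_; length)
  open import Data.List.Properties using (length-map)
  open Padding

  encodes-unique : ∀ {x us us′} → Encodes T x us → Encodes T x us′ → ∀ j → us j ≡ us′ j
  encodes-unique {x} {us} {us′} enc enc′ j =
    padded-injective (length x ∸ length (us j)) (length x ∸ length (us′ j)) (≡.trans (≡.sym (proj₂ (enc j))) (proj₂ (enc′ j)))

  encodes-cong : ∀ {x us us′} → (∀ j → us j ≡ us′ j) → Encodes T x us → Encodes T x us′
  encodes-cong {x} eq enc j = ≡.subst (λ u → InL (lookup T j) u × (track T j x ≡ pad (length x) u)) (eq j) (enc j)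

  length-≤ : ∀ {x us} → Encodes T x us → ∀ j → length (us j) ≤ length x
  length-≤ {x} {us} enc j = ℕ.≤-trans (ℕ.m≤n+m (length (us j)) (length x ∸ length (us j))) (ℕ.≤-reflexive
    (≡.trans (≡.sym (length-padded _ (us j))) (≡.trans (≡.cong length (≡.sym (proj₂ (enc j)))) (length-map _ x))))

  -- Some component of the first letter of x is not #, so that track is not
  -- padded: x is exactly as long as one of the encoded words.
  encodes-length-≤ : ∀ {x x′ us} → Encodes T x us → Encodes T x′ us → length x ≤ length x′
  encodes-length-≤ {[]}    _   _    = z≤n
  encodes-length-≤ {b ∷ x} {x′} {us} enc enc′ with ¬∀⟶∃¬ e (λ j → proj₁ b j ≡ nothing) (λ j → nothing? (proj₁ b j)) (proj₂ b)
  ... | j , bⱼ≢# = ℕ.≤-trans {suc (length x)} (ℕ.m∸n≡0⇒m≤n (nonblank-head (suc (length x) ∸ length (us j)) bⱼ≢# (proj₂ (enc j))))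
                             (length-≤ {x′} {us} enc′ j)

  encodes-length : ∀ {x x′ us} → Encodes T x us → Encodes T x′ us → length x ≡ length x′
  encodes-length {x} {x′} {us} enc enc′ =
    ℕ.≤-antisym (encodes-length-≤ {x} {x′} {us} enc enc′) (encodes-length-≤ {x′} {x} {us} enc′ enc)

-- Tuples of optional letters (the letters of a system, plus the all-#
-- tuple) are coded by Fin (size T), so that they can be summed over.
module Codes where

  open import Data.Nat using (zero; suc; _*_)
  import Data.Nat.Properties as ℕ
  open import Data.Fin using (zero; suc; combine; remQuot)
  open import Data.List using (List; []; _∷_; map; length)
  open import Data.List.Properties using (∷-injective)
  open import Data.Fin.Properties using (remQuot-combine; combine-remQuot)
  open import Data.Maybe using (Maybe; just; nothing)
  open import Data.Maybe.Properties using (just-injective)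
  open import Data.Product using (_×_; proj₁; proj₂)
  open import Data.Vec using ([]; _∷_)

  OptLetter : ANS → Set
  OptLetter A = Maybe (Fin (ANS.alph A))

  size : ∀ {e} → System e → ℕ
  size []      = 1
  size (A ∷ T) = suc (ANS.alph A) * size T

  fromFin : ∀ {k} → Fin (suc k) → Maybe (Fin k)
  fromFin zero    = nothing
  fromFin (suc i) = just i

  toFin : ∀ {k} → Maybe (Fin k) → Fin (suc k)
  toFin nothing  = zero
  toFin (just i) = suc i

  fromFin-toFin : ∀ {k} (m : Maybe (Fin k)) → fromFin (toFin m) ≡ m
  fromFin-toFin nothing  = ≡.refl
  fromFin-toFin (just i) = ≡.refl

  fromFin-injective : ∀ {k} {a b : Fin (suc k)} → fromFin a ≡ fromFin b → a ≡ b
  fromFin-injective {a = zero}  {zero}  _  = ≡.refl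
  fromFin-injective {a = suc a} {suc b} eq = ≡.cong suc (just-injective eq)
  fromFin-injective {a = zero}  {suc b} ()
  fromFin-injective {a = suc a} {zero}  ()

  digits : ∀ A {e} (T : System e) → Fin (size (A ∷ T)) → Fin (suc (ANS.alph A)) × Fin (size T)
  digits A T = remQuot (size T)

  decode : ∀ {e} (T : System e) → Fin (size T) → Fam OptLetter T
  decode (A ∷ T) c zero    = fromFin (proj₁ (digits A T c))
  decode (A ∷ T) c (suc j) = decode T (proj₂ (digits A T c)) j

  encode : ∀ {e} (T : System e) → Fam OptLetter T → Fin (size T)
  encode []      o = zero
  encode (A ∷ T) o = combine (toFin (o zero)) (encode T (o ∘ suc))

  decode-encode : ∀ {e} (T : System e) o j → decode T (encode T o) j ≡ o j
  decode-encode (A ∷ T) o zero =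
    ≡.trans (≡.cong (fromFin ∘ proj₁) (remQuot-combine (toFin (o zero)) (encode T (o ∘ suc)))) (fromFin-toFin (o zero))
  decode-encode (A ∷ T) o (suc j) =
    ≡.trans (≡.cong (λ p → decode T (proj₂ p) j) (remQuot-combine (toFin (o zero)) (encode T (o ∘ suc))))
            (decode-encode T (o ∘ suc) j)

  decode-injective : ∀ {e} (T : System e) {c c′} → (∀ j → decode T c j ≡ decode T c′ j) → c ≡ c′
  decode-injective []      {zero} {zero} _ = ≡.refl
  decode-injective (A ∷ T) {c}    {c′}   eq = begin
    c                                                 ≡⟨ ≡.sym (combine-remQuot (size T) c) ⟩
    combine (proj₁ (digits A T c))  (proj₂ (digits A T c))
      ≡⟨ ≡.cong₂ combine (fromFin-injective (eq zero)) (decode-injective T (eq ∘ suc)) ⟩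
    combine (proj₁ (digits A T c′)) (proj₂ (digits A T c′)) ≡⟨ combine-remQuot (size T) c′ ⟩
    c′                                                ∎
    where open ≡.≡-Reasoning

  codeTrack : ∀ {e} (T : System e) → List (Fin (size T)) → Fam (List ∘ OptLetter) T
  codeTrack T cs j = map (λ c → decode T c j) cs

  codeTrack-injective : ∀ {e} (T : System e) {cs cs′} → length cs ≡ length cs′ →
                        (∀ j → codeTrack T cs j ≡ codeTrack T cs′ j) → cs ≡ cs′
  codeTrack-injective T {[]}     {[]}       _    _  = ≡.refl
  codeTrack-injective T {c ∷ cs} {c′ ∷ cs′} |cs| eq = ≡.cong₂ _∷_
    (decode-injective T (λ j → proj₁ (∷-injective (eq j))))
    (codeTrack-injective T (ℕ.suc-injective |cs|) (λ j → proj₂ (∷-injective (eq j))))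

  private
    uncons : ∀ {X : Set} {m} (l : List X) → length l ≡ suc m → Σ (X × List X) λ (x , t) → l ≡ x ∷ t × length t ≡ m
    uncons (x ∷ t) |l| = (x , t) , ≡.refl , ℕ.suc-injective |l|

  transpose : ∀ {e} (T : System e) m (tr : Fam (List ∘ OptLetter) T) → (∀ j → length (tr j) ≡ m) →
              Σ (List (Fin (size T))) λ cs → (∀ j → codeTrack T cs j ≡ tr j) × length cs ≡ m
  transpose T zero    tr |tr| = [] , (λ j → empty (tr j) (|tr| j)) , ≡.refl
    where
    empty : ∀ {X : Set} (l : List X) → length l ≡ 0 → [] ≡ l
    empty [] _ = ≡.refl
  transpose T (suc m) tr |tr| = encode T (proj₁ ∘ heads) ∷ proj₁ rest , tracks , ≡.cong suc (proj₂ (proj₂ rest))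
    where
    split = λ j → uncons (tr j) (|tr| j)
    heads = λ j → proj₁ (split j)
    rest  = transpose T m (proj₂ ∘ heads) (λ j → proj₂ (proj₂ (split j)))
    tracks : ∀ j → codeTrack T (encode T (proj₁ ∘ heads) ∷ proj₁ rest) j ≡ tr j
    tracks j = ≡.trans (≡.cong₂ _∷_ (decode-encode T _ j) (proj₁ (proj₂ rest) j)) (≡.sym (proj₁ (proj₂ (split j))))

module Automata {A : Set} (D : DFA A) where

  open import Data.Nat using (_<_; _+_; _∸_; suc)
  import Data.Nat.Properties as ℕ
  open import Data.Fin using (toℕ)
  import Data.Fin.Properties as Fin
  open import Data.List using (List; []; _∷_; _++_; take; drop; length)
  open import Data.List.Properties using (++-assoc; take++drop≡id; length-++; length-take; length-drop)

  run-++ : ∀ q (u v : List A) → runDFA D q (u ++ v) ≡ runDFA D (runDFA D q u) v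
  run-++ q []      v = ≡.refl
  run-++ q (a ∷ u) v = run-++ (DFA.δ D q a) u v

  -- Among the nStates + 1 prefixes of xs two reach the same state (pigeonhole);
  -- cutting out the factor between them does not change where the run ends.
  loop : ∀ q (xs : List A) → DFA.nStates D ≤ length xs →
         Σ ℕ λ a → Σ ℕ λ b → a < b × b ≤ length xs × (∀ y → runDFA D q ((take a xs ++ drop b xs) ++ y) ≡ runDFA D q (xs ++ y))
  loop q xs long with Fin.pigeonhole (ℕ.n<1+n (DFA.nStates D)) (λ a → runDFA D q (take (toℕ a) xs))
  ... | a , b , a<b , same = toℕ a , toℕ b , a<b , ℕ.≤-trans (ℕ.≤-pred (Fin.toℕ<n b)) long , λ y → begin
    runDFA D q ((take (toℕ a) xs ++ drop (toℕ b) xs) ++ y) ≡⟨ ≡.cong (runDFA D q) (++-assoc (take (toℕ a) xs) _ y) ⟩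
    runDFA D q (take (toℕ a) xs ++ (drop (toℕ b) xs ++ y)) ≡⟨ run-++ q (take (toℕ a) xs) _ ⟩
    runDFA D (runDFA D q (take (toℕ a) xs)) (drop (toℕ b) xs ++ y) ≡⟨ ≡.cong (λ q′ → runDFA D q′ (drop (toℕ b) xs ++ y)) same ⟩
    runDFA D (runDFA D q (take (toℕ b) xs)) (drop (toℕ b) xs ++ y) ≡⟨ run-++ q (take (toℕ b) xs) _ ⟨
    runDFA D q (take (toℕ b) xs ++ (drop (toℕ b) xs ++ y)) ≡⟨ ≡.cong (runDFA D q) (++-assoc (take (toℕ b) xs) _ y) ⟨
    runDFA D q ((take (toℕ b) xs ++ drop (toℕ b) xs) ++ y) ≡⟨ ≡.cong (λ z → runDFA D q (z ++ y)) (take++drop≡id (toℕ b) xs) ⟩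
    runDFA D q (xs ++ y) ∎
    where open ≡.≡-Reasoning

  length-cut : ∀ {a b} (xs : List A) → a < b → b ≤ length xs → length (take a xs ++ drop b xs) < length xs
  length-cut {a} {b} xs a<b b≤|xs| = begin-strict
    length (take a xs ++ drop b xs)       ≡⟨ length-++ (take a xs) ⟩
    length (take a xs) + length (drop b xs)
      ≡⟨ ≡.cong₂ _+_ (≡.trans (length-take a xs) (ℕ.m≤n⇒m⊓n≡m (ℕ.≤-trans (ℕ.<⇒≤ a<b) b≤|xs|))) (length-drop b xs) ⟩
    a + (length xs ∸ b)                   <⟨ ℕ.+-monoˡ-< (length xs ∸ b) a<b ⟩
    b + (length xs ∸ b)                   ≡⟨ ℕ.m+[n∸m]≡n b≤|xs| ⟩
    length xs                             ∎
    where open ℕ.≤-Reasoning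

module Construction {c ℓ} (𝕂 : Semiring c ℓ) {d d′ : ℕ} (S : System d) (S′ : System d′)
                    (D : DFA (Letter (S ⊕ S′))) (R : LinRep 𝕂 (Letter S′)) where

  import Data.Nat as ℕ
  open import Data.Bool using (Bool)
  open import Data.Fin using (zero; suc; combine; remQuot; _≟_)
  open import Data.Fin.Properties using (all?; remQuot-combine)
  open import Data.List using (List; []; _∷_; _++_; length; zipWith; replicate)
  open import Data.List.Relation.Unary.All using (All; []; _∷_)
  open import Data.List.Properties using (map-++; length-++)
  open import Data.Nat using (suc)
  import Data.Nat.Properties as ℕ
  open import Data.Maybe using (maybe′)
  import Data.Maybe as Maybe
  open import Data.Product using (_,_; proj₁; proj₂)
  open import Relation.Nullary using (¬_; does)
  open Semiring 𝕂 hiding (zero)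
  open SemiringSums 𝕂
  open import Relation.Binary.Reasoning.Setoid setoid
  open Concat S′
  open Codes
  open DFA D using (δ; final) renaming (start to q₀; nStates to nQ)
  open LinRep R using (μ; λv; γ) renaming (dim to r)
  open Words (size S′) using (words; wordsUpTo)

  U : System (d ℕ.+ d′)
  U = S ⊕ S′

  Code : Set
  Code = Fin (size S′)

  letterOf : Code → Fam OptLetter S′
  letterOf = decode S′

  Blank : Code → Set
  Blank c = ∀ j → letterOf c j ≡ nothing

  blank? : ∀ c → Dec (Blank c)
  blank? c = all? (λ j → nothing? (letterOf c j))

  all-#-left : ∀ {t : Fam OptLetter S} {o} → (∀ J → join OptLetter S t o J ≡ nothing) → ∀ i → t i ≡ nothing
  all-#-left {t} {o} all# i = ≡.trans (≡.sym (left-join OptLetter S t o i))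
                             (left-pointwise {G = OptLetter} (λ _ x _ → x ≡ nothing) S {s = join OptLetter S t o} all# i)

  all-#-right : ∀ {t : Fam OptLetter S} {o} → (∀ J → join OptLetter S t o J ≡ nothing) → ∀ j → o j ≡ nothing
  all-#-right {t} {o} all# j = ≡.trans (≡.sym (right-join OptLetter S t o j))
                             (right-pointwise {G = OptLetter} (λ _ x _ → x ≡ nothing) S {s = join OptLetter S t o} all# j)

  withCode : Letter S → Code → Letter U
  withCode a c = join OptLetter S (proj₁ a) (letterOf c) , proj₂ a ∘ all-#-left

  padLetter : (c : Code) → ¬ Blank c → Letter U
  padLetter c c≢# = join OptLetter S (λ _ → nothing) (letterOf c) , c≢# ∘ all-#-right

  lettersOf : List Code → MWord S′
  lettersOf []       = []
  lettersOf (c ∷ cs) with blank? c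
  ... | yes _   = lettersOf cs
  ... | no c≢# = (letterOf c , c≢#) ∷ lettersOf cs

  padding : List Code → Maybe (List (Letter U))
  padding []       = just []
  padding (c ∷ cs) with blank? c
  ... | yes _   = nothing
  ... | no c≢# = Maybe.map (padLetter c c≢# ∷_) (padding cs)

  stepMat : Code → Mat 𝕂 r
  stepMat c with blank? c
  ... | yes _   = idMat 𝕂
  ... | no c≢# = μ (letterOf c , c≢#)

  stepMat-col : ∀ c cs i → sum (λ l → stepMat c i l * col R (lettersOf cs) l) ≈ col R (lettersOf (c ∷ cs)) i
  stepMat-col c cs i with blank? c
  ... | yes _   = idMat-apply i (col R (lettersOf cs))
  ... | no c≢# = sym (col-∷ R (letterOf c , c≢#) (lettersOf cs) i)

  -- States of the new representation are pairs (q, i) of a state of D and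
  -- an index of R, coded by combine q i.
  state : Fin (nQ ℕ.* r) → Fin nQ
  state s = proj₁ (remQuot {nQ} r s)

  index : Fin (nQ ℕ.* r) → Fin r
  index s = proj₂ (remQuot {nQ} r s)

  μᶜ : Letter S → Fin nQ → Fin r → Fin nQ → Fin r → Carrier
  μᶜ a q i q′ i′ = sum (λ c → when (does (δ q (withCode a c) ≟ q′)) (stepMat c i i′))

  rowᶜ : List Code → Fin r → Carrier
  rowᶜ p i = sum (λ k → λv k * μ* 𝕂 R (lettersOf p) k i)

  λᶜ : List Code → Fin nQ → Fin r → Carrier
  λᶜ p q i = maybe′ (λ xs → when (does (runDFA D q₀ xs ≟ q)) (rowᶜ p i)) 0# (padding p)

  composed : LinRep 𝕂 (Letter S)
  composed = record
    { dim = nQ ℕ.* r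
    ; μ   = λ a s s′ → μᶜ a (state s) (index s) (state s′) (index s′)
    ; λv  = λ s → lsum (wordsUpTo nQ) (λ p → λᶜ p (state s) (index s))
    ; γ   = λ s → when (final (state s)) (γ (index s))
    }

  suffixSum : MWord S → Fin nQ → Fin r → Carrier
  suffixSum w q i = lsum (words (length w)) (λ bs → when (final (runDFA D q (zipWith withCode w bs))) (col R (lettersOf bs) i))

  col-composed : ∀ w q i → col composed w (combine q i) ≈ suffixSum w q i
  col-composed [] q i = begin
    col composed [] (combine q i)                ≈⟨ col-[] composed (combine q i) ⟩
    when (final (state (combine q i))) (γ (index (combine q i)))
      ≡⟨ ≡.cong (λ p → when (final (proj₁ p)) (γ (proj₂ p))) (remQuot-combine q i) ⟩
    when (final q) (γ i)                        ≈⟨ when-cong (final q) (sym (col-[] R i)) ⟩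
    when (final q) (col R [] i)                 ≈⟨ sym (+-identityʳ _) ⟩
    suffixSum [] q i ∎
  col-composed (a ∷ w) q i = begin
    col composed (a ∷ w) (combine q i)
      ≈⟨ col-∷ composed a w (combine q i) ⟩
    sum {nQ ℕ.* r} (λ s → μᶜ′ s * col composed w s)
      ≈⟨ sum-combine nQ r (λ s → μᶜ′ s * col composed w s) ⟩
    sum {nQ} (λ q′ → sum {r} (λ i′ → μᶜ′ (combine q′ i′) * col composed w (combine q′ i′)))
      ≈⟨ sum-cong-≋ {nQ} (λ q′ → sum-cong-≋ {r} (λ i′ → *-cong (reflexive (μ-coords q′ i′)) (col-composed w q′ i′))) ⟩
    sum {nQ} (λ q′ → sum {r} (λ i′ → μᶜ a q i q′ i′ * suffixSum w q′ i′))
      ≈⟨ sum-transition (λ c → δ q (withCode a c)) (λ c i′ → stepMat c i i′) (suffixSum w) ⟩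
    sum {size S′} (λ c → sum {r} (λ i′ → stepMat c i i′ * suffixSum w (δ q (withCode a c)) i′))
      ≈⟨ sum-cong-≋ {size S′} (λ c → sum-*-lsum-when (words (length w)) (stepMat c i) (accepting c) (col R ∘ lettersOf)) ⟩
    sum {size S′} (λ c → lsum (words (length w)) (λ bs →
      when (accepting c bs) (sum {r} (λ i′ → stepMat c i i′ * col R (lettersOf bs) i′))))
      ≈⟨ sum-cong-≋ {size S′} (λ c → sum-cong-≋ {length (words (length w))} (λ l →
           when-cong (accepting c (lookup′ l)) (stepMat-col c (lookup′ l) i))) ⟩
    sum {size S′} (λ c → lsum (words (length w)) (λ bs → when (accepting c bs) (col R (lettersOf (c ∷ bs)) i)))
      ≈⟨ sym (Words.lsum-words-suc (size S′) 𝕂 (length w)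
               (λ bs → when (final (runDFA D q (zipWith withCode (a ∷ w) bs))) (col R (lettersOf bs) i))) ⟩
    suffixSum (a ∷ w) q i ∎
    where
    μᶜ′ : Fin (nQ ℕ.* r) → Carrier
    μᶜ′ = LinRep.μ composed a (combine q i)
    μ-coords : ∀ q′ i′ → μᶜ′ (combine q′ i′) ≡ μᶜ a q i q′ i′
    μ-coords q′ i′ = ≡.cong₂ (λ p p′ → μᶜ a (proj₁ p) (proj₂ p) (proj₁ p′) (proj₂ p′)) (remQuot-combine q i) (remQuot-combine q′ i′)
    accepting : Code → List Code → Bool
    accepting c bs = final (runDFA D (δ q (withCode a c)) (zipWith withCode w bs))
    lookup′ = Data.List.lookup (words (length w))

  rowᶜ-col : ∀ p v → sum (λ i → rowᶜ p i * col R v i) ≈ evalRep 𝕂 R (lettersOf p ++ v)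
  rowᶜ-col p v = begin
    sum {r} (λ i → rowᶜ p i * col R v i)                              ≈⟨ vecMatVec-assoc λv (μ* 𝕂 R (lettersOf p)) (col R v) ⟩
    sum {r} (λ k → λv k * sum {r} (λ i → μ* 𝕂 R (lettersOf p) k i * col R v i))
      ≈⟨ sum-cong-≋ {r} (λ k → *-congˡ (col-++ R (lettersOf p) v k)) ⟩
    sum {r} (λ k → λv k * col R (lettersOf p ++ v) k)                  ≈⟨ sym (evalRep-col R (lettersOf p ++ v)) ⟩
    evalRep 𝕂 R (lettersOf p ++ v)                                    ∎

  weight : MWord S → List Code → List Code → Carrier
  weight w p bs = maybe′ (λ xs → when (final (runDFA D (runDFA D q₀ xs) (zipWith withCode w bs)))
                                      (evalRep 𝕂 R (lettersOf p ++ lettersOf bs)))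
                         0# (padding p)

  prefix-contribution : ∀ w p → sum {nQ} (λ q → sum {r} (λ i → λᶜ p q i * suffixSum w q i))
                                ≈ lsum (words (length w)) (weight w p)
  prefix-contribution w p with padding p
  ... | nothing = trans (sum-zero {nQ} (λ q → sum-zero {r} (λ i → zeroˡ _))) (sym (lsum-zero (words (length w))))
  ... | just xs = begin
    sum {nQ} (λ q → sum {r} (λ i → when (does (q₁ ≟ q)) (rowᶜ p i) * suffixSum w q i))
      ≈⟨ sum-cong-≋ {nQ} (λ q → trans (sum-cong-≋ {r} (λ i → when-*ʳ (does (q₁ ≟ q)) (rowᶜ p i) (suffixSum w q i)))
                                        (sum-when (does (q₁ ≟ q)) (λ i → rowᶜ p i * suffixSum w q i))) ⟩
    sum {nQ} (λ q → when (does (q₁ ≟ q)) (sum {r} (λ i → rowᶜ p i * suffixSum w q i)))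
      ≈⟨ sum-when-≟ q₁ (λ q → sum {r} (λ i → rowᶜ p i * suffixSum w q i)) ⟩
    sum {r} (λ i → rowᶜ p i * suffixSum w q₁ i)
      ≈⟨ sum-*-lsum-when (words (length w)) (rowᶜ p) accepting (col R ∘ lettersOf) ⟩
    lsum (words (length w)) (λ bs → when (accepting bs) (sum {r} (λ i → rowᶜ p i * col R (lettersOf bs) i)))
      ≈⟨ sum-cong-≋ {length (words (length w))} (λ l → when-cong (accepting (lookup′ l)) (rowᶜ-col p (lettersOf (lookup′ l)))) ⟩
    lsum (words (length w)) (λ bs → when (accepting bs) (evalRep 𝕂 R (lettersOf p ++ lettersOf bs))) ∎
    where
    q₁ = runDFA D q₀ xs
    accepting : List Code → Bool
    accepting bs = final (runDFA D q₁ (zipWith withCode w bs))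
    lookup′ = Data.List.lookup (words (length w))

  evalRep-composed : ∀ w → evalRep 𝕂 composed w ≈ lsum (wordsUpTo nQ) (λ p → lsum (words (length w)) (weight w p))
  evalRep-composed w = begin
    evalRep 𝕂 composed w
      ≈⟨ evalRep-col composed w ⟩
    sum {nQ ℕ.* r} (λ s → λᶜ′ s * col composed w s)
      ≈⟨ sum-combine nQ r (λ s → λᶜ′ s * col composed w s) ⟩
    sum {nQ} (λ q → sum {r} (λ i → λᶜ′ (combine q i) * col composed w (combine q i)))
      ≈⟨ sum-cong-≋ {nQ} (λ q → sum-cong-≋ {r} (λ i → *-cong (reflexive (λ-coords q i)) (col-composed w q i))) ⟩
    sum {nQ} (λ q → sum {r} (λ i → lsum P (λ p → λᶜ p q i) * suffixSum w q i))
      ≈⟨ sum-cong-≋ {nQ} (λ q → sum-cong-≋ {r} (λ i → *-distribʳ-sum (suffixSum w q i) (λ l → λᶜ (lookup′ l) q i))) ⟩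
    sum {nQ} (λ q → sum {r} (λ i → lsum P (λ p → λᶜ p q i * suffixSum w q i)))
      ≈⟨ sum-cong-≋ {nQ} (λ q → ∑-comm {r} {length P} (λ i l → λᶜ (lookup′ l) q i * suffixSum w q i)) ⟩
    sum {nQ} (λ q → lsum P (λ p → sum {r} (λ i → λᶜ p q i * suffixSum w q i)))
      ≈⟨ ∑-comm {nQ} {length P} (λ q l → sum {r} (λ i → λᶜ (lookup′ l) q i * suffixSum w q i)) ⟩
    lsum P (λ p → sum {nQ} (λ q → sum {r} (λ i → λᶜ p q i * suffixSum w q i)))
      ≈⟨ sum-cong-≋ {length P} (λ l → prefix-contribution w (lookup′ l)) ⟩
    lsum P (λ p → lsum (words (length w)) (weight w p)) ∎
    where
    P = wordsUpTo nQ
    lookup′ = Data.List.lookup P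
    λᶜ′ : Fin (nQ ℕ.* r) → Carrier
    λᶜ′ = LinRep.λv composed
    λ-coords : ∀ q i → λᶜ′ (combine q i) ≡ lsum P (λ p → λᶜ p q i)
    λ-coords q i = ≡.cong (λ c → lsum P (λ p → λᶜ p (proj₁ c) (proj₂ c))) (remQuot-combine q i)

  -- the word read by D: an S-blank prefix, then w with the codes bs on the S′-tracks
  joint : List (Letter U) → MWord S → List Code → List (Letter U)
  joint xs w bs = xs ++ zipWith withCode w bs

  partˡ : Letter U → Fam OptLetter S
  partˡ l = left OptLetter S (proj₁ l)

  partʳ : Letter U → Fam OptLetter S′
  partʳ l = right OptLetter S (proj₁ l)

  SBlank : Letter U → Set
  SBlank l = ∀ i → partˡ l i ≡ nothing

  trackˡ : List (Letter U) → ∀ i → List (OptLetter (lookup S i))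
  trackˡ x i = Data.List.map (λ l → partˡ l i) x

  trackʳ : List (Letter U) → ∀ j → List (OptLetter (lookup S′ j))
  trackʳ x j = Data.List.map (λ l → partʳ l j) x

  left-track : ∀ x i → left (List ∘ OptLetter) S (λ J → track U J x) i ≡ trackˡ x i
  left-track x i = left-map OptLetter S proj₁ x i

  right-track : ∀ x j → right (List ∘ OptLetter) S (λ J → track U J x) j ≡ trackʳ x j
  right-track x j = right-map OptLetter S proj₁ x j

  record Padded (p : List Code) (xs : List (Letter U)) : Set where
    field
      blank   : All SBlank xs
      codes   : ∀ j → trackʳ xs j ≡ codeTrack S′ p j
      length≡ : length xs ≡ length p

  padding-Padded : ∀ p {xs} → padding p ≡ just xs → Padded p xs
  padding-Padded []       ≡.refl = record { blank = [] ; codes = λ _ → ≡.refl ; length≡ = ≡.refl }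
  padding-Padded (c ∷ cs) eq with blank? c
  padding-Padded (c ∷ cs) () | yes _
  ... | no c≢# with padding cs in eq′
  padding-Padded (c ∷ cs) () | no c≢# | nothing
  padding-Padded (c ∷ cs) ≡.refl | no c≢# | just xs = record
    { blank   = left-join OptLetter S (λ _ → nothing) (letterOf c) ∷ Padded.blank rest
    ; codes   = λ j → ≡.cong₂ _∷_ (right-join OptLetter S (λ _ → nothing) (letterOf c) j) (Padded.codes rest j)
    ; length≡ = ≡.cong suc (Padded.length≡ rest)
    }
    where rest = padding-Padded cs eq′

  trackˡ-blank : ∀ {xs} → All SBlank xs → ∀ i → trackˡ xs i ≡ replicate (length xs) nothing
  trackˡ-blank []           i = ≡.refl
  trackˡ-blank (bl ∷ blank) i = ≡.cong₂ _∷_ (bl i) (trackˡ-blank blank i)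

  module _ {w : MWord S} {bs : List Code} where

    trackˡ-zip : length bs ≡ length w → ∀ i → trackˡ (zipWith withCode w bs) i ≡ track S i w
    trackˡ-zip = go w bs
      where
      go : ∀ w bs → length bs ≡ length w → ∀ i → trackˡ (zipWith withCode w bs) i ≡ track S i w
      go []      []       _  i = ≡.refl
      go (a ∷ w) (c ∷ bs) eq i = ≡.cong₂ _∷_ (left-join OptLetter S (proj₁ a) (letterOf c) i) (go w bs (ℕ.suc-injective eq) i)

    trackʳ-zip : length bs ≡ length w → ∀ j → trackʳ (zipWith withCode w bs) j ≡ codeTrack S′ bs j
    trackʳ-zip = go w bs
      where
      go : ∀ w bs → length bs ≡ length w → ∀ j → trackʳ (zipWith withCode w bs) j ≡ codeTrack S′ bs j
      go []      []       _  j = ≡.refl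
      go (a ∷ w) (c ∷ bs) eq j = ≡.cong₂ _∷_ (right-join OptLetter S (proj₁ a) (letterOf c) j) (go w bs (ℕ.suc-injective eq) j)

    length-zip : length bs ≡ length w → length (zipWith withCode w bs) ≡ length w
    length-zip = go w bs
      where
      go : ∀ w bs → length bs ≡ length w → length (zipWith withCode w bs) ≡ length w
      go []      []       _  = ≡.refl
      go (a ∷ w) (c ∷ bs) eq = ≡.cong suc (go w bs (ℕ.suc-injective eq))

  trackˡ-joint : ∀ {xs w bs} → All SBlank xs → length bs ≡ length w →
                 ∀ i → trackˡ (joint xs w bs) i ≡ replicate (length xs) nothing ++ track S i w
  trackˡ-joint {xs} {w} {bs} blank |bs| i =
    ≡.trans (map-++ _ xs (zipWith withCode w bs)) (≡.cong₂ _++_ (trackˡ-blank blank i) (trackˡ-zip |bs| i))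

  trackʳ-joint : ∀ {p xs w bs} → Padded p xs → length bs ≡ length w → ∀ j → trackʳ (joint xs w bs) j ≡ codeTrack S′ (p ++ bs) j
  trackʳ-joint {p} {xs} {w} {bs} pad |bs| j =
    ≡.trans (map-++ _ xs (zipWith withCode w bs))
            (≡.trans (≡.cong₂ _++_ (Padded.codes pad j) (trackʳ-zip |bs| j)) (≡.sym (map-++ _ p bs)))

  length-joint : ∀ {p xs w bs} → Padded p xs → length bs ≡ length w → length (joint xs w bs) ≡ length (p ++ bs)
  length-joint {p} {xs} {w} {bs} pad |bs| =
    ≡.trans (length-++ xs) (≡.trans (≡.cong₂ ℕ._+_ (Padded.length≡ pad) (≡.trans (length-zip {w} {bs} |bs|) (≡.sym |bs|)))
                                    (≡.sym (length-++ p)))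

InGraph : ∀ {d d′} (S : System d) (S′ : System d′) → (Vec ℕ d → Vec ℕ d′) → MWord (S ⊕ S′) → Set
InGraph {d} S S′ f x =
  Σ (Fam Word (S ⊕ S′)) λ tt → Encodes (S ⊕ S′) x tt × Σ (Vec ℕ d) λ n → valT (S ⊕ S′) tt ≡ n Data.Vec.++ f n

module Correctness {c ℓ} (𝕂 : Semiring c ℓ) {d d′ : ℕ} (S : System d) (S′ : System d′)
                   (f : Vec ℕ d → Vec ℕ d′) (g : Vec ℕ d′ → Semiring.Carrier 𝕂)
                   (D : DFA (Letter (S ⊕ S′)))
                   (D-graph : ∀ x → (accepts D x ≡ true → InGraph S S′ f x) × (InGraph S S′ f x → accepts D x ≡ true))
                   (R : LinRep 𝕂 (Letter S′))
                   (R-g : ∀ w → (∀ us → Encodes S′ w us → Semiring._≈_ 𝕂 (evalRep 𝕂 R w) (g (valT S′ us)))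
                               × (¬ InK S′ w → Semiring._≈_ 𝕂 (evalRep 𝕂 R w) (Semiring.0# 𝕂))) where

  open import Data.Bool using (false)
  open import Data.Fin.Properties using (¬∀⟶∃¬)
  open import Data.List using (List; []; _∷_; _++_; map; length; zipWith; replicate; take; drop)
  open import Data.List.Properties using (length-map; length-++; ∷-injective; take-map; length-drop; take++drop≡id)
  open import Data.List.Relation.Unary.All using (All; []; _∷_)
  import Data.List.Relation.Unary.All.Properties as All
  open import Data.Nat using (suc; _+_; _∸_; _<_; _⊔_)
  import Data.Nat.Properties as ℕ
  open import Data.Product using (map₁)
  open import Data.Sum using (inj₁; inj₂)
  import Data.Vec as Vec
  open import Data.Vec.Properties using (++-injectiveˡ; ++-injectiveʳ)
  open import Relation.Nullary using (contradiction)
  open Semiring 𝕂 using (_≈_; 0#; setoid)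
  open Construction 𝕂 S S′ D R
  open Concat S′
  open Codes
  open SemiringSums 𝕂 using (lsum)
  open Words (size S′) using (words; wordsUpTo)
  open Padding
  open Maximum
  open DFA D using (final) renaming (start to q₀; nStates to nQ)

  TrackOf : ℕ → (A : ANS) → Word A → List (OptLetter A) → Set
  TrackOf n A u tr = InL A u × tr ≡ pad n u

  record Reading (w : MWord S) (x : List (Letter U)) : Set where
    field
      tuple    : Fam Word U
      encodes  : Encodes U x tuple
      encodesˡ : Encodes S w (left Word S tuple)
      graph    : valT S′ (right Word S tuple) ≡ f (valT S (left Word S tuple))

  accepted-Reading : ∀ {w xs bs} → All SBlank xs → length bs ≡ length w → accepts D (joint xs w bs) ≡ true →
                     Reading w (joint xs w bs)
  accepted-Reading {w} {xs} {bs} blank |bs| acc with proj₁ (D-graph (joint xs w bs)) acc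
  ... | tt , enc , n , tt↦n++fn = record { tuple = tt ; encodes = enc ; encodesˡ = encˡ ; graph = graph }
    where
    x = joint xs w bs
    encˡ : Encodes S w (left Word S tt)
    encˡ i = proj₁ piece , ≡.trans
      (unpad (length xs) (length x ∸ length u) (track S i w) u (≡.trans (≡.sym (trackˡ-joint blank |bs| i)) tr))
      (≡.cong (λ n → pad n u) (length-map (λ b → proj₁ b i) w))
      where
      u = left Word S tt i
      piece = left-pointwise (TrackOf (length x)) S enc i
      tr : trackˡ x i ≡ pad (length x) (left Word S tt i)
      tr = ≡.trans (≡.sym (left-track x i)) (proj₂ piece)
    split : valT S (left Word S tt) Vec.++ valT S′ (right Word S tt) ≡ n Vec.++ f n
    split = ≡.trans (≡.sym (valT-⊕ S tt)) tt↦n++fn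
    graph : valT S′ (right Word S tt) ≡ f (valT S (left Word S tt))
    graph = ≡.trans (++-injectiveʳ _ _ split) (≡.cong f (≡.sym (++-injectiveˡ _ _ split)))

  -- Two readings of w carry the same tuple: the S-parts are the words
  -- encoded by w, and the S′-parts are then fixed by f and injectivity of val.
  readings-tuple : ∀ {w x x′} (ρ : Reading w x) (ρ′ : Reading w x′) → ∀ J → Reading.tuple ρ J ≡ Reading.tuple ρ′ J
  readings-tuple {w} {x} {x′} ρ ρ′ = join-pointwise (λ _ u u′ → u ≡ u′) S sameˡ sameʳ
    where
    open Reading ρ
    open Reading ρ′ renaming (tuple to tuple′; encodes to encodes′; encodesˡ to encodesˡ′; graph to graph′)
    sameˡ : ∀ i → left Word S tuple i ≡ left Word S tuple′ i
    sameˡ = Encodings.encodes-unique S {w} encodesˡ encodesˡ′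
    inLʳ : ∀ {x} {tt : Fam Word U} → Encodes U x tt → ∀ j → InL (lookup S′ j) (right Word S tt j)
    inLʳ {x} enc j = proj₁ (right-pointwise (TrackOf (length x)) S enc j)
    sameʳ : ∀ j → right Word S tuple j ≡ right Word S tuple′ j
    sameʳ = valT-injective S′ (inLʳ encodes) (inLʳ encodes′)
              (≡.trans graph (≡.trans (≡.cong f (valT-cong S sameˡ)) (≡.sym graph′)))

  readings-length : ∀ {w x x′} → Reading w x → Reading w x′ → length x ≡ length x′
  readings-length {x′ = x′} ρ ρ′ = Encodings.encodes-length U {us = Reading.tuple ρ} (Reading.encodes ρ)
    (Encodings.encodes-cong U {x′} {Reading.tuple ρ′} (≡.sym ∘ readings-tuple ρ ρ′) (Reading.encodes ρ′))

  readings-track : ∀ {w x x′} → Reading w x → Reading w x′ → ∀ J → track U J x ≡ track U J x′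
  readings-track ρ ρ′ J = ≡.trans (proj₂ (Reading.encodes ρ J)) (≡.trans
    (≡.cong₂ pad (readings-length ρ ρ′) (readings-tuple ρ ρ′ J)) (≡.sym (proj₂ (Reading.encodes ρ′ J))))

  record Accepted (w : MWord S) (p bs : List Code) : Set where
    field
      prefix   : List (Letter U)
      padded   : padding p ≡ just prefix
      aligned  : length bs ≡ length w
      accepted : accepts D (joint prefix w bs) ≡ true

    isPadded : Padded p prefix
    isPadded = padding-Padded p padded

    reading : Reading w (joint prefix w bs)
    reading = accepted-Reading (Padded.blank isPadded) aligned accepted

    codeTrack≡ : ∀ j → codeTrack S′ (p ++ bs) j ≡ right (List ∘ OptLetter) S (λ J → track U J (joint prefix w bs)) j
    codeTrack≡ j = ≡.sym (≡.trans (right-track _ j) (trackʳ-joint isPadded aligned j))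

  ++-injective : ∀ {X : Set} {p p′ bs bs′ : List X} → length p ≡ length p′ → p ++ bs ≡ p′ ++ bs′ → p ≡ p′ × bs ≡ bs′
  ++-injective {p = []}    {[]}     _   eq = ≡.refl , eq
  ++-injective {p = a ∷ p} {a′ ∷ p′} |p| eq with ∷-injective eq
  ... | ≡.refl , eq′ = map₁ (≡.cong (a ∷_)) (++-injective (ℕ.suc-injective |p|) eq′)

  accepted-unique : ∀ {w p bs p′ bs′} → Accepted w p bs → Accepted w p′ bs′ → p ≡ p′ × bs ≡ bs′
  accepted-unique {w} {p} {bs} {p′} {bs′} α α′ = ++-injective |p| (codeTrack-injective S′ |p++bs| same-codes)
    where
    module α  = Accepted α
    module α′ = Accepted α′
    |x| = readings-length α.reading α′.reading
    |p++bs| : length (p ++ bs) ≡ length (p′ ++ bs′)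
    |p++bs| = ≡.trans (≡.sym (length-joint α.isPadded α.aligned)) (≡.trans |x| (length-joint α′.isPadded α′.aligned))
    |p| : length p ≡ length p′
    |p| = ℕ.+-cancelʳ-≡ (length bs) (length p) (length p′)
            (≡.trans (≡.sym (length-++ p)) (≡.trans |p++bs| (≡.trans (length-++ p′)
              (≡.cong (length p′ +_) (≡.trans α′.aligned (≡.sym α.aligned))))))
    same-codes : ∀ j → codeTrack S′ (p ++ bs) j ≡ codeTrack S′ (p′ ++ bs′) j
    same-codes j = ≡.trans (α.codeTrack≡ j) (≡.trans
      (right-pointwise (λ _ t t′ → t ≡ t′) S (readings-track α.reading α′.reading) j) (≡.sym (α′.codeTrack≡ j)))

  -- Cutting a loop of D out of the S-blank prefix would give a shorter
  -- accepted word reading w, but all readings of w have the same length.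
  prefix-short : ∀ {w xs bs} → All SBlank xs → length bs ≡ length w → accepts D (joint xs w bs) ≡ true → length xs < nQ
  prefix-short {w} {xs} {bs} blank |bs| acc with length xs ℕ.<? nQ
  ... | yes short = short
  ... | no  long with Automata.loop D q₀ xs (ℕ.≮⇒≥ long)
  ...   | a , b , a<b , b≤|xs| , same-run = contradiction (readings-length cut-reading reading) (ℕ.<⇒≢ shorter)
    where
    cut = take a xs ++ drop b xs
    y = zipWith withCode w bs
    cut-reading = accepted-Reading (All.++⁺ (All.take⁺ a blank) (All.drop⁺ b blank)) |bs|
                                   (≡.trans (≡.cong final (same-run y)) acc)
    reading = accepted-Reading blank |bs| acc
    shorter : length (cut ++ y) < length (xs ++ y)
    shorter = ℕ.≤-trans (ℕ.≤-reflexive (≡.cong suc (length-++ cut)))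
                (ℕ.≤-trans (ℕ.+-monoˡ-< (length y) (Automata.length-cut D xs a<b b≤|xs|)) (ℕ.≤-reflexive (≡.sym (length-++ xs))))

  lettersOf-++ : ∀ p bs → lettersOf (p ++ bs) ≡ lettersOf p ++ lettersOf bs
  lettersOf-++ []       bs = ≡.refl
  lettersOf-++ (c ∷ p) bs with blank? c
  ... | yes _   = lettersOf-++ p bs
  ... | no c≢# = ≡.cong ((letterOf c , c≢#) ∷_) (lettersOf-++ p bs)

  lettersOf-unpadded : ∀ cs {j₀ u} → codeTrack S′ cs j₀ ≡ map just u →
                       (∀ j → track S′ j (lettersOf cs) ≡ codeTrack S′ cs j) × length (lettersOf cs) ≡ length cs
  lettersOf-unpadded []       _ = (λ _ → ≡.refl) , ≡.refl
  lettersOf-unpadded (c ∷ cs) {j₀} {x ∷ u} eq with blank? c | ∷-injective eq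
  ... | yes blank | c≡x , _ = contradiction (≡.trans (≡.sym c≡x) (blank j₀)) λ ()
  ... | no _      | _ , eq′ with lettersOf-unpadded cs eq′
  ...   | tracks , |cs| = (λ j → ≡.cong (letterOf c j ∷_) (tracks j)) , ≡.cong suc |cs|

  lettersOf-encodes : ∀ cs (vs : Fam Word S′) → (∀ j → codeTrack S′ cs j ≡ pad (length cs) (vs j)) →
                      ∀ j → track S′ j (lettersOf cs) ≡ pad (length (lettersOf cs)) (vs j)
  lettersOf-encodes []       vs tr = tr
  lettersOf-encodes (c ∷ cs) vs tr with blank? c
  ... | yes blank = lettersOf-encodes cs vs λ j →
    pad-tail (length cs) {u = vs j} (≡.trans (≡.cong (_∷ codeTrack S′ cs j) (≡.sym (blank j))) (tr j))
  ... | no c≢# with ¬∀⟶∃¬ d′ _ (λ j → nothing? (letterOf c j)) c≢#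
  ...   | j₀ , cⱼ₀≢# with lettersOf-unpadded cs (map-just-tail unpadded)
    where
    unpadded : letterOf c j₀ ∷ codeTrack S′ cs j₀ ≡ map just (vs j₀)
    unpadded = ≡.trans (tr j₀) (≡.cong (λ a → replicate a nothing ++ map just (vs j₀))
                                         (nonblank-head (suc (length cs) ∸ length (vs j₀)) cⱼ₀≢# (tr j₀)))
  ...     | tracks , |cs| = λ j → ≡.trans (≡.cong (letterOf c j ∷_) (tracks j))
                                           (≡.trans (tr j) (≡.cong (λ n → pad (suc n) (vs j)) (≡.sym |cs|)))

  accepted-value : ∀ {w p bs us} → Accepted w p bs → Encodes S w us →
                   evalRep 𝕂 R (lettersOf p ++ lettersOf bs) ≈ g (f (valT S us))
  accepted-value {w} {p} {bs} {us} α enc = begin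
    evalRep 𝕂 R (lettersOf p ++ lettersOf bs) ≡⟨ ≡.cong (evalRep 𝕂 R) (lettersOf-++ p bs) ⟨
    evalRep 𝕂 R (lettersOf (p ++ bs))         ≈⟨ proj₁ (R-g (lettersOf (p ++ bs))) (right Word S tuple) encʳ ⟩
    g (valT S′ (right Word S tuple))
      ≡⟨ ≡.cong g (≡.trans graph (≡.cong f (valT-cong S same-tuple))) ⟩
    g (f (valT S us))                          ∎
    where
    open Accepted α
    open Reading reading
    open import Relation.Binary.Reasoning.Setoid setoid
    x = joint prefix w bs
    same-tuple : ∀ i → left Word S tuple i ≡ us i
    same-tuple = Encodings.encodes-unique S {w} {left Word S tuple} {us} encodesˡ enc
    piece : ∀ j → TrackOf (length x) (lookup S′ j) (right Word S tuple j) (right (List ∘ OptLetter) S (λ J → track U J x) j)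
    piece = right-pointwise (TrackOf (length x)) S encodes
    encʳ : Encodes S′ (lettersOf (p ++ bs)) (right Word S tuple)
    encʳ j = proj₁ (piece j) , lettersOf-encodes (p ++ bs) (right Word S tuple) (λ j → ≡.trans (codeTrack≡ j)
               (≡.trans (proj₂ (piece j)) (≡.cong (λ n → pad n (right Word S tuple j)) (length-joint isPadded aligned)))) j

  joint-encodes : ∀ {p xs w bs us vs} → Padded p xs → length bs ≡ length w → Encodes S w us →
                  (∀ j → InL (lookup S′ j) (vs j)) → (∀ j → codeTrack S′ (p ++ bs) j ≡ pad (length (p ++ bs)) (vs j)) →
                  Encodes U (joint xs w bs) (join Word S us vs)
  joint-encodes {p} {xs} {w} {bs} {us} {vs} padded |bs| enc vs∈L tracks = join-pointwise (TrackOf (length x)) S encˡ encʳ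
    where
    x = joint xs w bs
    |x| : length xs + length w ≡ length x
    |x| = ≡.sym (≡.trans (length-++ xs) (≡.cong (length xs +_) (length-zip {w} {bs} |bs|)))
    encˡ : ∀ i → TrackOf (length x) (lookup S i) (left Word S (join Word S us vs) i)
                                                 (left (List ∘ OptLetter) S (λ J → track U J x) i)
    encˡ i rewrite left-join Word S us vs i = proj₁ (enc i) , (begin
      left (List ∘ OptLetter) S (λ J → track U J x) i ≡⟨ ≡.trans (left-track x i) (trackˡ-joint (Padded.blank padded) |bs| i) ⟩
      replicate (length xs) nothing ++ track S i w    ≡⟨ ≡.cong (replicate (length xs) nothing ++_) (proj₂ (enc i)) ⟩
      replicate (length xs) nothing ++ pad (length w) (us i)
        ≡⟨ pad-shift (length xs) {u = us i} (Encodings.length-≤ S {w} {us} enc i) ⟩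
      pad (length xs + length w) (us i)               ≡⟨ ≡.cong (λ n → pad n (us i)) |x| ⟩
      pad (length x) (us i)                           ∎)
      where open ≡.≡-Reasoning
    encʳ : ∀ j → TrackOf (length x) (lookup S′ j) (right Word S (join Word S us vs) j)
                                                  (right (List ∘ OptLetter) S (λ J → track U J x) j)
    encʳ j rewrite right-join Word S us vs j = vs∈L j ,
      ≡.trans (≡.trans (right-track x j) (trackʳ-joint padded |bs| j))
              (≡.trans (tracks j) (≡.cong (λ n → pad n (vs j)) (≡.sym (length-joint padded |bs|))))

  padding-exists : ∀ p {j₀ u} → codeTrack S′ p j₀ ≡ map just u → Σ (List (Letter U)) λ xs → padding p ≡ just xs
  padding-exists []       _ = [] , ≡.refl
  padding-exists (c ∷ p) {j₀} {x ∷ u} eq with blank? c | ∷-injective eq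
  ... | yes blank | c≡x , _ = contradiction (≡.trans (≡.sym c≡x) (blank j₀)) λ ()
  ... | no c≢#   | _ , eq′ with padding-exists p eq′
  ...   | xs , padded = padLetter c c≢# ∷ xs , ≡.cong (Data.Maybe.map (padLetter c c≢# ∷_)) padded

  padding-take : ∀ k cs {j₀ v} → codeTrack S′ cs j₀ ≡ map just v → Σ (List (Letter U)) λ xs → padding (take k cs) ≡ just xs
  padding-take k cs {j₀} {v} eq = padding-exists (take k cs) {j₀}
    (≡.trans (≡.sym (take-map k cs)) (≡.trans (≡.cong (take k) eq) (take-map k v)))

  -- D accepts the padded parallel reading of (us, vs) for vs representing
  -- f (valT us); its first m ∸ |w| letters are # on the S-tracks.
  exists-accepted : ∀ {w} us → Encodes S w us → Σ (List Code) λ p → Σ (List Code) λ bs → Accepted w p bs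
  exists-accepted {w} us enc =
    p , bs , record { prefix = proj₁ prefix ; padded = proj₂ prefix ; aligned = |bs| ; accepted = accepted }
    where
    image = valT-surjective S′ (f (valT S us))
    vs = proj₁ image
    M = maxOver (length ∘ vs)
    m = length w ⊔ M
    m∸m≡0 : ∀ {n} → m ≡ n → m ∸ n ≡ 0
    m∸m≡0 {n} m≡n = ≡.trans (≡.cong (_∸ n) m≡n) (ℕ.n∸n≡0 n)
    |vs|≤m : ∀ j → length (vs j) ≤ m
    |vs|≤m j = ℕ.≤-trans (≤-maxOver (length ∘ vs) j) (ℕ.m≤n⊔m (length w) M)
    columns = transpose S′ m (λ j → pad m (vs j)) (λ j → ≡.trans (length-padded _ (vs j)) (ℕ.m∸n+n≡m (|vs|≤m j)))
    cs = proj₁ columns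
    tracks : ∀ j → codeTrack S′ cs j ≡ pad m (vs j)
    tracks = proj₁ (proj₂ columns)
    k = m ∸ length w
    p = take k cs
    bs = drop k cs
    |bs| : length bs ≡ length w
    |bs| = ≡.trans (length-drop k cs) (≡.trans (≡.cong (_∸ k) (proj₂ (proj₂ columns))) (ℕ.m∸[m∸n]≡n (ℕ.m≤m⊔n (length w) M)))
    prefix : Σ (List (Letter U)) λ xs → padding p ≡ just xs
    prefix with ⊔-maxOver-attained (length w) (length ∘ vs)
    ... | inj₁ m≡|w|          = [] , ≡.cong (λ k → padding (take k cs)) (m∸m≡0 m≡|w|)
    ... | inj₂ (j₀ , m≡|vⱼ₀|) = padding-take k cs (≡.trans (tracks j₀)
                                  (≡.cong (λ a → replicate a nothing ++ map just (vs j₀)) (m∸m≡0 m≡|vⱼ₀|)))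
    padded = padding-Padded p (proj₂ prefix)
    tracks′ : ∀ j → codeTrack S′ (p ++ bs) j ≡ pad (length (p ++ bs)) (vs j)
    tracks′ j rewrite take++drop≡id k cs | proj₂ (proj₂ columns) = tracks j
    accepted = proj₂ (D-graph (joint (proj₁ prefix) w bs))
      (join Word S us vs , joint-encodes padded |bs| enc (proj₁ (proj₂ image)) tracks′ , valT S us ,
       ≡.trans (valT-join S us vs) (≡.cong (valT S us Vec.++_) (proj₂ (proj₂ image))))

  weight-accepted : ∀ {w p bs} (α : Accepted w p bs) → weight w p bs ≈ evalRep 𝕂 R (lettersOf p ++ lettersOf bs)
  weight-accepted {w} {p} {bs} α
    rewrite Accepted.padded α | ≡.sym (Automata.run-++ D q₀ (Accepted.prefix α) (zipWith withCode w bs)) | Accepted.accepted α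
    = Semiring.refl 𝕂

  weight-rejected : ∀ {w p bs} → length bs ≡ length w → ¬ Accepted w p bs → weight w p bs ≈ 0#
  weight-rejected {w} {p} {bs} |bs| ¬α with padding p in padded
  ... | nothing = Semiring.refl 𝕂
  ... | just xs with final (runDFA D (runDFA D q₀ xs) (zipWith withCode w bs)) in acc
  ...   | false = Semiring.refl 𝕂
  ...   | true  = contradiction (record { prefix = xs ; padded = padded ; aligned = |bs|
                                        ; accepted = ≡.trans (≡.cong final (Automata.run-++ D q₀ xs _)) acc }) ¬α

  composed-outside : ∀ w → ¬ InK S w → evalRep 𝕂 composed w ≈ 0#
  composed-outside w w∉K = Semiring.trans 𝕂 (evalRep-composed w)
    (Words.lsum-wordsUpTo-zero (size S′) 𝕂 nQ λ p _ → Words.lsum-words-zero (size S′) 𝕂 (length w) λ bs |bs| →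
      weight-rejected {w} {p} {bs} |bs| λ α → w∉K (reads α))
    where
    reads : ∀ {p bs} → Accepted w p bs → InK S w
    reads α = left Word S (Reading.tuple (Accepted.reading α)) , Reading.encodesˡ (Accepted.reading α)

  composed-encodes : ∀ w us → Encodes S w us → evalRep 𝕂 composed w ≈ g (f (valT S us))
  composed-encodes w us enc with exists-accepted us enc
  ... | p₀ , bs₀ , α₀ = begin
    evalRep 𝕂 composed w                                         ≈⟨ evalRep-composed w ⟩
    lsum (wordsUpTo nQ) (λ p → lsum (words (length w)) (weight w p))
      ≈⟨ Words.lsum-wordsUpTo-single (size S′) 𝕂 nQ p₀ |p₀|≤nQ other-prefix ⟩
    lsum (words (length w)) (weight w p₀)
      ≈⟨ Words.lsum-words-single (size S′) 𝕂 (length w) bs₀ (Accepted.aligned α₀) other-codes ⟩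
    weight w p₀ bs₀                                               ≈⟨ weight-accepted α₀ ⟩
    evalRep 𝕂 R (lettersOf p₀ ++ lettersOf bs₀)                  ≈⟨ accepted-value {us = us} α₀ enc ⟩
    g (f (valT S us))                                             ∎
    where
    open import Relation.Binary.Reasoning.Setoid setoid
    |p₀|≤nQ : length p₀ ≤ nQ
    |p₀|≤nQ = ℕ.<⇒≤ (≡.subst (_< nQ) (Padded.length≡ (Accepted.isPadded α₀))
                      (prefix-short (Padded.blank (Accepted.isPadded α₀)) (Accepted.aligned α₀) (Accepted.accepted α₀)))
    other-prefix : ∀ p → length p ≤ nQ → p ≢ p₀ → lsum (words (length w)) (weight w p) ≈ 0#
    other-prefix p _ p≢p₀ = Words.lsum-words-zero (size S′) 𝕂 (length w) λ bs |bs| →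
      weight-rejected {w} {p} {bs} |bs| λ α → p≢p₀ (proj₁ (accepted-unique α α₀))
    other-codes : ∀ bs → length bs ≡ length w → bs ≢ bs₀ → weight w p₀ bs ≈ 0#
    other-codes bs |bs| bs≢bs₀ = weight-rejected {w} {p₀} {bs} |bs| λ α → bs≢bs₀ (proj₂ (accepted-unique α α₀))

theorem9p8 : ∀ {c ℓ} (𝕂 : Semiring c ℓ) {d d' : ℕ} → 1 ≤ d → 1 ≤ d'
    → (S : System d) (S' : System d')
    → (f : Vec ℕ d → Vec ℕ d') (g : Vec ℕ d' → Semiring.Carrier 𝕂)
    → Synchronized S S' f
    → RegularSeq 𝕂 S' g
    → RegularSeq 𝕂 S (g ∘ f)
theorem9p8 𝕂 _ _ S S′ f g (D , D-graph) (R , R-g) =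
  Construction.composed 𝕂 S S′ D R , λ w → composed-encodes w , composed-outside w
  where open Correctness 𝕂 S S′ f g D D-graph R R-g
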